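{- Let $M$ be a term of the $\partial_0\lambda$-calculus (without tests) whose free variables are $\vec x=x_1,\dots,x_n$. If $M$ reduces to a normal form different from $0$, then there are a finite sequence $\vec P=P_1,\dots,P_m$ of closed bags and a sequence $\vec P'=P'_1,\dots,P'_n$ of closed bags such that $$(MP_1\cdots P_m)\langle\vec P'/\vec x\rangle\{0/\vec x\}\twoheadrightarrow\mathbf I+\mathbb M$$ for some finite sum of terms $\mathbb M$.
   Context: The $\partial_0\lambda$-calculus (without tests). Terms $M::=x\mid\lambda x.M\mid MP$, bags $P::=[L_1,\dots,L_k]$ ($k\ge0$, a finite multiset of terms), up to $\alpha$-equivalence. Sums of terms are finite formal sums with idempotent addition, $0$ the empty sum; constructors are extended to sums multilinearly (e.g. $\lambda x.\sum_iM_i=\sum_i\lambda x.M_i$, $(\sum_iM_i)(\sum_jP_j)=\sum_{i,j}M_iP_j$, $[\sum_iL_i]\uplus P=\sum_i[L_i]\uplus P$), so constructors applied to $0$ give $0$. $A\{0/x\}$ equals $0$ if $x$ is free in $A$ and $A$ otherwise; $A\{0/\vec x\}$ applies this for each $x_i$. Linear substitution: $x\langle N/x\rangle=N$, $y\langle N/x\rangle=0$ ($y\ne x$), $(\lambda y.M)\langle N/x\rangle=\lambda y.M\langle N/x\rangle$, $(MP)\langle N/x\rangle=M\langle N/x\rangle P+M(P\langle N/x\rangle)$, $[L_1,\dots,L_k]\langle N/x\rangle=\sum_i[L_1,\dots,L_i\langle N/x\rangle,\dots,L_k]$; for $P=[L_1,\dots,L_k]$ with $x$ not free in $P$, $A\langle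 P/x\rangle:=A\langle L_1/x\rangle\cdots\langle L_k/x\rangle$, and $A\langle\vec P'/\vec x\rangle:=A\langle P'_1/x_1\rangle\cdots\langle P'_n/x_n\rangle$. The only reduction rule is $(\lambda x.M)P\to M\langle P/x\rangle\{0/x\}$, closed under all syntactic positions and under sums; $\twoheadrightarrow$ is the reflexive-transitive closure. A term (sum) is in normal form if no reduction applies to it (to any of its summands). "$M$ reduces to a normal form different from $0$" means $M\twoheadrightarrow\mathbb N$ with $\mathbb N\neq0$ a sum in normal form. $\mathbf I:=\lambda x.x$. -}

module Defs where

open import Data.Nat using (ℕ; zero; suc)
open import Data.Fin using (Fin; zero; suc; _≟_)
open import Data.List using (List; []; _∷_; _++_; map; concatMap; foldl; allFin)
open import Data.List.Relation.Unary.All using (All)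
open import Data.List.Relation.Unary.Any using (Any)
open import Data.Maybe using (Maybe; just; nothing)
open import Data.Product using (_×_)
open import Data.Sum using (_⊎_)
open import Relation.Nullary using (yes; no)
open import Relation.Binary.Construct.Closure.ReflexiveTransitive using (Star)

-- Bags are finite multisets, represented
-- by lists and identified up to permutation via _≈_ / _≈ᵇ_ below.

data Term (n : ℕ) : Set where
  var : Fin n → Term n
  lam : Term (suc n) → Term n
  app : Term n → List (Term n) → Term n

Bag : ℕ → Set
Bag n = List (Term n)

-- Finite sums of terms (idempotent addition; 0 = []).  Sums are identified
-- up to _≈ˢ_ (same summands up to _≈_), which makes + idempotent,
-- commutative and associative.
Sum : ℕ → Set
Sum n = List (Term n)

data _≈_ : ∀ {n} → Term n → Term n → Set
data _≈ᵇ_ : ∀ {n} → Bag n → Bag n → Set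

data _≈_ where
  var : ∀ {n} (i : Fin n) → var i ≈ var i
  lam : ∀ {n} {M M' : Term (suc n)} → M ≈ M' → lam M ≈ lam M'
  app : ∀ {n} {M M' : Term n} {P P' : Bag n} → M ≈ M' → P ≈ᵇ P' → app M P ≈ app M' P'

data _≈ᵇ_ where
  []    : ∀ {n} → _≈ᵇ_ {n} [] []
  _∷_   : ∀ {n} {L L' : Term n} {P P' : Bag n} → L ≈ L' → P ≈ᵇ P' → (L ∷ P) ≈ᵇ (L' ∷ P')
  swap  : ∀ {n} (L L' : Term n) (P : Bag n) → (L ∷ L' ∷ P) ≈ᵇ (L' ∷ L ∷ P)
  trans : ∀ {n} {P Q R : Bag n} → P ≈ᵇ Q → Q ≈ᵇ R → P ≈ᵇ R

_≈ˢ_ : ∀ {n} → Sum n → Sum n → Set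
𝕄 ≈ˢ 𝕄' = All (λ M → Any (M ≈_) 𝕄') 𝕄 × All (λ M' → Any (_≈ M') 𝕄) 𝕄'

data FreeIn : ∀ {n} → Fin n → Term n → Set
data FreeInᵇ : ∀ {n} → Fin n → Bag n → Set

data FreeIn where
  var  : ∀ {n} (i : Fin n) → FreeIn i (var i)
  lam  : ∀ {n} {i : Fin n} {M} → FreeIn (suc i) M → FreeIn i (lam M)
  appL : ∀ {n} {i : Fin n} {M P} → FreeIn i M → FreeIn i (app M P)
  appR : ∀ {n} {i : Fin n} {M P} → FreeInᵇ i P → FreeIn i (app M P)

data FreeInᵇ where
  here  : ∀ {n} {i : Fin n} {L P} → FreeIn i L → FreeInᵇ i (L ∷ P)
  there : ∀ {n} {i : Fin n} {L P} → FreeInᵇ i P → FreeInᵇ i (L ∷ P)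

ext : ∀ {n m} → (Fin n → Fin m) → Fin (suc n) → Fin (suc m)
ext ρ zero    = zero
ext ρ (suc i) = suc (ρ i)

ren  : ∀ {n m} → (Fin n → Fin m) → Term n → Term m
renᵇ : ∀ {n m} → (Fin n → Fin m) → Bag n → Bag m
ren ρ (var i)   = var (ρ i)
ren ρ (lam M)   = lam (ren (ext ρ) M)
ren ρ (app M P) = app (ren ρ M) (renᵇ ρ P)
renᵇ ρ []       = []
renᵇ ρ (L ∷ P)  = ren ρ L ∷ renᵇ ρ P

shift : ∀ {n} → Term n → Term (suc n)
shift = ren suc

wk0 : ∀ {n} → Term 0 → Term n
wk0 = ren (λ ())

-- Erasure A{0/x}: a partial renaming ρ (nothing = variable replaced by 0).
-- If a variable mapped to nothing occurs free, the result is 0 (nothing);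
-- otherwise the term is re-indexed.

extᵐ : ∀ {n m} → (Fin n → Maybe (Fin m)) → Fin (suc n) → Maybe (Fin (suc m))
extᵐ ρ zero    = just zero
extᵐ ρ (suc i) = Data.Maybe.map suc (ρ i)

erase  : ∀ {n m} → (Fin n → Maybe (Fin m)) → Term n → Maybe (Term m)
eraseᵇ : ∀ {n m} → (Fin n → Maybe (Fin m)) → Bag n → Maybe (Bag m)
erase ρ (var i) with ρ i
... | just j  = just (var j)
... | nothing = nothing
erase ρ (lam M) with erase (extᵐ ρ) M
... | just M' = just (lam M')
... | nothing = nothing
erase ρ (app M P) with erase ρ M | eraseᵇ ρ P
... | just M' | just P' = just (app M' P')
... | _       | _       = nothing
eraseᵇ ρ [] = just []
eraseᵇ ρ (L ∷ P) with erase ρ L | eraseᵇ ρ P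
... | just L' | just P' = just (L' ∷ P')
... | _       | _       = nothing

maybeToSum : ∀ {n} → Maybe (Term n) → Sum n
maybeToSum (just M) = M ∷ []
maybeToSum nothing  = []

eraseS : ∀ {n m} → (Fin n → Maybe (Fin m)) → Sum n → Sum m
eraseS ρ = concatMap (λ A → maybeToSum (erase ρ A))

pop : ∀ {n} → Fin (suc n) → Maybe (Fin n)
pop zero    = nothing
pop (suc i) = just i

allZero : ∀ {n} → Fin n → Maybe (Fin 0)
allZero _ = nothing

lsub  : ∀ {n} → Fin n → Term n → Term n → Sum n
lsubᵇ : ∀ {n} → Fin n → Term n → Bag n → List (Bag n)
lsub x N (var y) with y ≟ x
... | yes _ = N ∷ []
... | no _  = []
lsub x N (lam M)   = map lam (lsub (suc x) (shift N) M)
lsub x N (app M P) = map (λ M' → app M' P) (lsub x N M) ++ map (app M) (lsubᵇ x N P)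
lsubᵇ x N []       = []
lsubᵇ x N (L ∷ P)  = map (_∷ P) (lsub x N L) ++ map (L ∷_) (lsubᵇ x N P)

lsubS : ∀ {n} → Fin n → Term n → Sum n → Sum n
lsubS x N 𝕄 = concatMap (lsub x N) 𝕄

bagSubS : ∀ {n} → Fin n → Bag n → Sum n → Sum n
bagSubS x P 𝕄 = foldl (λ acc L → lsubS x L acc) 𝕄 P

multiSubS : ∀ {n} → Sum n → (Fin n → Bag 0) → Sum n
multiSubS {n} 𝕄 P' = foldl (λ acc i → bagSubS i (map wk0 (P' i)) acc) 𝕄 (allFin n)

data _⟶_ : ∀ {n} → Term n → Sum n → Set
data _⟶ᵇ_ : ∀ {n} → Bag n → List (Bag n) → Set

data _⟶_ where
  β    : ∀ {n} (M : Term (suc n)) (P : Bag n) →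
         app (lam M) P ⟶ eraseS pop (bagSubS zero (map shift P) (M ∷ []))
  lam  : ∀ {n} {M : Term (suc n)} {𝕄} → M ⟶ 𝕄 → lam M ⟶ map lam 𝕄
  appL : ∀ {n} {M : Term n} {P 𝕄} → M ⟶ 𝕄 → app M P ⟶ map (λ M' → app M' P) 𝕄
  appR : ∀ {n} {M : Term n} {P ℙ} → P ⟶ᵇ ℙ → app M P ⟶ map (app M) ℙ

data _⟶ᵇ_ where
  here  : ∀ {n} {L : Term n} {P 𝕃} → L ⟶ 𝕃 → (L ∷ P) ⟶ᵇ map (_∷ P) 𝕃
  there : ∀ {n} {L : Term n} {P ℙ} → P ⟶ᵇ ℙ → (L ∷ P) ⟶ᵇ map (L ∷_) ℙ

data _⇒_ {n} : Sum n → Sum n → Set where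
  step : ∀ (A B : Sum n) {M 𝕄} → M ⟶ 𝕄 → (A ++ M ∷ B) ⇒ (A ++ 𝕄 ++ B)

_↠_ : ∀ {n} → Sum n → Sum n → Set
_↠_ = Star (λ 𝕄 𝕄' → 𝕄 ⇒ 𝕄' ⊎ 𝕄 ≈ˢ 𝕄')

Normal : ∀ {n} → Sum n → Set
Normal 𝕟 = All (λ N → ∀ 𝕄 → N ⟶ 𝕄 → Data.Empty.⊥) 𝕟
  where import Data.Empty

I : Term 0
I = lam (var zero)

apps : ∀ {n} → Term n → List (Bag 0) → Term n
apps M Ps = foldl (λ t P → app t (map wk0 P)) M Ps

-- Following the reduction of M back from a summand N of its normal form gives
-- a chain of single summands M ⟶ ⋯ ⟶ N.  Every normal form N is testable:
-- there are closed bags σ for its free variables and closed arguments Ps with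
-- N⟨σ⟩{0/x⃗} Ps ↠ I + ⋯ (an abstraction λx.N′ takes the resources of x as its
-- first argument; a neutral y Q₁ ⋯ Qₖ gets for its head y a λ-term that runs
-- the tests of the normal forms in the bags Qᵢ one after the other).  Closed
-- substitution can then be pulled back along the chain, since every summand
-- of an instance of a reduct is a reduct of an instance; in the β case this
-- is the commutation of closed with linear substitution.  So M⟨σ⟩{0/x⃗} Ps,
-- a summand of the term in the theorem, reduces to I + ⋯ as well.

module Submission where

open import Defs
open import Data.Nat using (ℕ; zero; suc)
open import Data.Fin using (Fin; zero; suc; _≟_)
open import Data.Fin.Properties using (suc-injective)
open import Data.List using (List; []; _∷_; _++_; map; foldl; allFin)
open import Data.List.Properties using (++-assoc; ++-identityʳ; ++-conicalˡ; ++-conicalʳ; map-++)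
open import Data.List.Membership.Propositional using (_∈_; find; lose)
open import Data.List.Membership.Propositional.Properties
  using (∈-++⁻; ∈-++⁺ˡ; ∈-++⁺ʳ; ∈-map⁺; ∈-map⁻; ∈-concatMap⁺; ∈-concatMap⁻; ∈-∃++; ∈-allFin)
open import Data.List.Relation.Unary.Any using (here; there)
import Data.List.Relation.Unary.All as All
open All using (All)
open import Data.List.Relation.Unary.Unique.Propositional using (Unique)
open import Data.List.Relation.Unary.Unique.Propositional.Properties using (allFin⁺)
open import Data.List.Relation.Unary.AllPairs.Core using (_∷_)
open import Data.List.Relation.Binary.Permutation.Propositional
  using (_↭_; ↭-refl; ↭-reflexive; ↭-sym; ↭-trans; ↭-prep; ↭-swap)
import Data.List.Relation.Binary.Permutation.Propositional as ↭
open import Data.List.Relation.Binary.Permutation.Propositional.Properties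
  using (↭-empty-inv; ↭-singleton-inv; ∈-resp-↭; drop-∷; ++⁺ˡ; ++⁺ʳ; ++⁺; shifts; ++-comm)
  renaming (map⁺ to ↭-map⁺; shift to ↭-shift)
open import Data.Maybe using (Maybe; just; nothing; maybe)
import Data.Maybe as Maybe
open import Data.Product using (∃; ∃-syntax; _×_; _,_; proj₁; proj₂)
open import Data.Sum using (_⊎_; inj₁; inj₂)
open import Data.Empty using (⊥; ⊥-elim)
open import Function using (_∘_; id)
open import Relation.Nullary using (¬_; yes; no)
open import Relation.Binary.PropositionalEquality
  using (_≡_; _≢_; refl; sym; cong; cong₂; subst; subst₂)
  renaming (trans to ≡-trans)
open import Relation.Binary.Construct.Closure.ReflexiveTransitive using (Star; ε; _◅_; _◅◅_)

-- Renaming and erasure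

ext-cong : ∀ {n m} {f g : Fin n → Fin m} → (∀ i → f i ≡ g i) → ∀ i → ext f i ≡ ext g i
ext-cong f≗g zero    = refl
ext-cong f≗g (suc i) = cong suc (f≗g i)

ren-cong  : ∀ {n m} {f g : Fin n → Fin m} → (∀ i → f i ≡ g i) → (A : Term n) → ren f A ≡ ren g A
renᵇ-cong : ∀ {n m} {f g : Fin n → Fin m} → (∀ i → f i ≡ g i) → (P : Bag n) → renᵇ f P ≡ renᵇ g P
ren-cong f≗g (var i)   = cong var (f≗g i)
ren-cong f≗g (lam A)   = cong lam (ren-cong (ext-cong f≗g) A)
ren-cong f≗g (app A P) = cong₂ app (ren-cong f≗g A) (renᵇ-cong f≗g P)
renᵇ-cong f≗g []      = refl
renᵇ-cong f≗g (L ∷ P) = cong₂ _∷_ (ren-cong f≗g L) (renᵇ-cong f≗g P)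

ext-∘ : ∀ {n m k} (f : Fin m → Fin k) (g : Fin n → Fin m) → ∀ i → ext f (ext g i) ≡ ext (f ∘ g) i
ext-∘ f g zero    = refl
ext-∘ f g (suc i) = refl

ren-∘  : ∀ {n m k} (f : Fin m → Fin k) (g : Fin n → Fin m) (A : Term n) → ren f (ren g A) ≡ ren (f ∘ g) A
renᵇ-∘ : ∀ {n m k} (f : Fin m → Fin k) (g : Fin n → Fin m) (P : Bag n) → renᵇ f (renᵇ g P) ≡ renᵇ (f ∘ g) P
ren-∘ f g (var i)   = refl
ren-∘ f g (lam A)   = cong lam (≡-trans (ren-∘ (ext f) (ext g) A) (ren-cong (ext-∘ f g) A))
ren-∘ f g (app A P) = cong₂ app (ren-∘ f g A) (renᵇ-∘ f g P)
renᵇ-∘ f g []      = refl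
renᵇ-∘ f g (L ∷ P) = cong₂ _∷_ (ren-∘ f g L) (renᵇ-∘ f g P)

ren-id  : ∀ {n} {f : Fin n → Fin n} → (∀ i → f i ≡ i) → (A : Term n) → ren f A ≡ A
renᵇ-id : ∀ {n} {f : Fin n → Fin n} → (∀ i → f i ≡ i) → (P : Bag n) → renᵇ f P ≡ P
ren-id f≗id (var i)   = cong var (f≗id i)
ren-id f≗id (lam A)   = cong lam (ren-id (λ { zero → refl ; (suc i) → cong suc (f≗id i) }) A)
ren-id f≗id (app A P) = cong₂ app (ren-id f≗id A) (renᵇ-id f≗id P)
renᵇ-id f≗id []      = refl
renᵇ-id f≗id (L ∷ P) = cong₂ _∷_ (ren-id f≗id L) (renᵇ-id f≗id P)

renᵇ-map : ∀ {n m} (f : Fin n → Fin m) (P : Bag n) → renᵇ f P ≡ map (ren f) P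
renᵇ-map f []      = refl
renᵇ-map f (L ∷ P) = cong (ren f L ∷_) (renᵇ-map f P)

ren-wk0 : ∀ {n m} (f : Fin n → Fin m) (c : Term 0) → ren f (wk0 c) ≡ wk0 c
ren-wk0 f c = ≡-trans (ren-∘ f (λ ()) c) (ren-cong (λ ()) c)

wk0-id : (c : Term 0) → wk0 c ≡ c
wk0-id = ren-id (λ ())

map-shift-wk0 : ∀ {n} (P : Bag 0) → map (shift {n}) (map wk0 P) ≡ map wk0 P
map-shift-wk0 []      = refl
map-shift-wk0 (L ∷ P) = cong₂ _∷_ (ren-wk0 suc L) (map-shift-wk0 P)

extᵐ-cong : ∀ {n m} {f g : Fin n → Maybe (Fin m)} → (∀ i → f i ≡ g i) → ∀ i → extᵐ f i ≡ extᵐ g i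
extᵐ-cong f≗g zero    = refl
extᵐ-cong f≗g (suc i) = cong (Maybe.map suc) (f≗g i)

erase-cong  : ∀ {n m} {f g : Fin n → Maybe (Fin m)} → (∀ i → f i ≡ g i) → (A : Term n) → erase f A ≡ erase g A
eraseᵇ-cong : ∀ {n m} {f g : Fin n → Maybe (Fin m)} → (∀ i → f i ≡ g i) → (P : Bag n) → eraseᵇ f P ≡ eraseᵇ g P
erase-cong f≗g (var i)   rewrite f≗g i = refl
erase-cong f≗g (lam A)   rewrite erase-cong (extᵐ-cong f≗g) A = refl
erase-cong f≗g (app A P) rewrite erase-cong f≗g A | eraseᵇ-cong f≗g P = refl
eraseᵇ-cong f≗g []      = refl
eraseᵇ-cong f≗g (L ∷ P) rewrite erase-cong f≗g L | eraseᵇ-cong f≗g P = refl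

erase-ren  : ∀ {n m k} (f : Fin m → Maybe (Fin k)) (g : Fin n → Fin m) (A : Term n) → erase f (ren g A) ≡ erase (f ∘ g) A
eraseᵇ-ren : ∀ {n m k} (f : Fin m → Maybe (Fin k)) (g : Fin n → Fin m) (P : Bag n) → eraseᵇ f (renᵇ g P) ≡ eraseᵇ (f ∘ g) P
erase-ren f g (var i)   = refl
erase-ren f g (lam A)
  rewrite erase-ren (extᵐ f) (ext g) A
        | erase-cong {f = extᵐ f ∘ ext g} {g = extᵐ (f ∘ g)} (λ { zero → refl ; (suc i) → refl }) A = refl
erase-ren f g (app A P) rewrite erase-ren f g A | eraseᵇ-ren f g P = refl
eraseᵇ-ren f g []      = refl
eraseᵇ-ren f g (L ∷ P) rewrite erase-ren f g L | eraseᵇ-ren f g P = refl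

erase-total  : ∀ {n m} {f : Fin n → Maybe (Fin m)} (h : Fin n → Fin m) → (∀ i → f i ≡ just (h i)) →
               (A : Term n) → erase f A ≡ just (ren h A)
eraseᵇ-total : ∀ {n m} {f : Fin n → Maybe (Fin m)} (h : Fin n → Fin m) → (∀ i → f i ≡ just (h i)) →
               (P : Bag n) → eraseᵇ f P ≡ just (renᵇ h P)
erase-total h f≗h (var i) rewrite f≗h i = refl
erase-total {f = f} h f≗h (lam A)
  rewrite erase-total {f = extᵐ f} (ext h) (λ { zero → refl ; (suc i) → cong (Maybe.map suc) (f≗h i) }) A = refl
erase-total h f≗h (app A P) rewrite erase-total h f≗h A | eraseᵇ-total h f≗h P = refl
eraseᵇ-total h f≗h []      = refl
eraseᵇ-total h f≗h (L ∷ P) rewrite erase-total h f≗h L | eraseᵇ-total h f≗h P = refl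

erase-var-inv : ∀ {n m} (f : Fin n → Maybe (Fin m)) (i : Fin n) {B} →
                erase f (var i) ≡ just B → ∃ λ j → f i ≡ just j × B ≡ var j
erase-var-inv f i e with f i
erase-var-inv f i refl | just j = j , refl , refl

erase-lam-inv : ∀ {n m} (f : Fin n → Maybe (Fin m)) (A : Term (suc n)) {B} →
                erase f (lam A) ≡ just B → ∃ λ A′ → erase (extᵐ f) A ≡ just A′ × B ≡ lam A′
erase-lam-inv f A e with erase (extᵐ f) A
erase-lam-inv f A refl | just A′ = A′ , refl , refl

erase-app-inv : ∀ {n m} (f : Fin n → Maybe (Fin m)) (A : Term n) (P : Bag n) {B} → erase f (app A P) ≡ just B →
                ∃ λ A′ → ∃ λ P′ → erase f A ≡ just A′ × eraseᵇ f P ≡ just P′ × B ≡ app A′ P′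
erase-app-inv f A P e with erase f A | eraseᵇ f P
erase-app-inv f A P refl | just A′ | just P′ = A′ , P′ , refl , refl , refl

eraseᵇ-∷-inv : ∀ {n m} (f : Fin n → Maybe (Fin m)) (L : Term n) (P : Bag n) {B} → eraseᵇ f (L ∷ P) ≡ just B →
               ∃ λ L′ → ∃ λ P′ → erase f L ≡ just L′ × eraseᵇ f P ≡ just P′ × B ≡ L′ ∷ P′
eraseᵇ-∷-inv f L P e with erase f L | eraseᵇ f P
eraseᵇ-∷-inv f L P refl | just L′ | just P′ = L′ , P′ , refl , refl , refl

map-ext-suc : ∀ {k k′} (h : Fin k → Fin k′) (o : Maybe (Fin k)) →
              Maybe.map (ext h) (Maybe.map suc o) ≡ Maybe.map suc (Maybe.map h o)
map-ext-suc h (just j) = refl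
map-ext-suc h nothing  = refl

erase-lam-just : ∀ {n m} (f : Fin n → Maybe (Fin m)) A {A′} → erase (extᵐ f) A ≡ just A′ → erase f (lam A) ≡ just (lam A′)
erase-lam-just f A e rewrite e = refl

erase-app-just : ∀ {n m} (f : Fin n → Maybe (Fin m)) A P {A′ P′} →
                 erase f A ≡ just A′ → eraseᵇ f P ≡ just P′ → erase f (app A P) ≡ just (app A′ P′)
erase-app-just f A P eA eP rewrite eA | eP = refl

eraseᵇ-∷-just : ∀ {n m} (f : Fin n → Maybe (Fin m)) L P {L′ P′} →
                erase f L ≡ just L′ → eraseᵇ f P ≡ just P′ → eraseᵇ f (L ∷ P) ≡ just (L′ ∷ P′)
eraseᵇ-∷-just f L P eL eP rewrite eL | eP = refl

map-nothing : ∀ {A B : Set} {h : A → B} {o} → o ≡ nothing → Maybe.map h o ≡ nothing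
map-nothing refl = refl

erase-map  : ∀ {n m k} (h : Fin m → Fin k) (f : Fin n → Maybe (Fin m)) (A : Term n) {B} →
             erase f A ≡ just B → erase (Maybe.map h ∘ f) A ≡ just (ren h B)
eraseᵇ-map : ∀ {n m k} (h : Fin m → Fin k) (f : Fin n → Maybe (Fin m)) (P : Bag n) {B} →
             eraseᵇ f P ≡ just B → eraseᵇ (Maybe.map h ∘ f) P ≡ just (renᵇ h B)
erase-map h f (var i) e with erase-var-inv f i e
... | j , fi , refl rewrite fi = refl
erase-map h f (lam A) e with erase-lam-inv f A e
... | A′ , eA , refl = erase-lam-just _ A (≡-trans (erase-cong extᵐ-map A) (erase-map (ext h) (extᵐ f) A eA))
  where
  extᵐ-map : ∀ i → extᵐ (Maybe.map h ∘ f) i ≡ Maybe.map (ext h) (extᵐ f i)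
  extᵐ-map zero    = refl
  extᵐ-map (suc i) = sym (map-ext-suc h (f i))
erase-map h f (app A P) e with erase-app-inv f A P e
... | A′ , P′ , eA , eP , refl = erase-app-just _ A P (erase-map h f A eA) (eraseᵇ-map h f P eP)
eraseᵇ-map h f [] refl = refl
eraseᵇ-map h f (L ∷ P) e with eraseᵇ-∷-inv f L P e
... | L′ , P′ , eL , eP , refl = eraseᵇ-∷-just _ L P (erase-map h f L eL) (eraseᵇ-map h f P eP)

erase-pop-shift : ∀ {n} (L : Term n) → erase pop (shift L) ≡ just L
erase-pop-shift L =
  ≡-trans (erase-ren pop suc L) (≡-trans (erase-total id (λ _ → refl) L) (cong just (ren-id (λ _ → refl) L)))

erase-extᵐ-shift : ∀ {n m} (f : Fin n → Maybe (Fin m)) N {L} →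
                   erase f N ≡ just L → erase (extᵐ f) (shift N) ≡ just (shift L)
erase-extᵐ-shift f N e = ≡-trans (erase-ren (extᵐ f) suc N) (erase-map suc f N e)

erase-wk0 : ∀ {n m} (f : Fin n → Maybe (Fin m)) (c : Term 0) → erase f (wk0 c) ≡ just (wk0 c)
erase-wk0 f c = ≡-trans (erase-ren f (λ ()) c) (erase-total (λ ()) (λ ()) c)

-- Sums and reduction

≈-refl  : ∀ {n} (A : Term n) → A ≈ A
≈ᵇ-refl : ∀ {n} (P : Bag n) → P ≈ᵇ P
≈-refl (var i)   = var i
≈-refl (lam A)   = lam (≈-refl A)
≈-refl (app A P) = app (≈-refl A) (≈ᵇ-refl P)
≈ᵇ-refl []      = []
≈ᵇ-refl (L ∷ P) = ≈-refl L ∷ ≈ᵇ-refl P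

mk≈ˢ : ∀ {n} {S S′ : Sum n} →
       (∀ {M} → M ∈ S → ∃ λ M′ → M′ ∈ S′ × M ≈ M′) → (∀ {M′} → M′ ∈ S′ → ∃ λ M → M ∈ S × M ≈ M′) → S ≈ˢ S′
mk≈ˢ fwd bwd = All.tabulate (λ m → let _ , m′ , e = fwd m in lose m′ e)
             , All.tabulate (λ m → let _ , m′ , e = bwd m in lose m′ e)

≈ˢ-fwd : ∀ {n} {S S′ : Sum n} → S ≈ˢ S′ → ∀ {M} → M ∈ S → ∃ λ M′ → M′ ∈ S′ × M ≈ M′
≈ˢ-fwd (fwd , _) m = find (All.lookup fwd m)

≈ˢ-bwd : ∀ {n} {S S′ : Sum n} → S ≈ˢ S′ → ∀ {M′} → M′ ∈ S′ → ∃ λ M → M ∈ S × M ≈ M′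
≈ˢ-bwd (_ , bwd) m = find (All.lookup bwd m)

⊆⊇⇒≈ˢ : ∀ {n} {S S′ : Sum n} → (∀ {M} → M ∈ S → M ∈ S′) → (∀ {M} → M ∈ S′ → M ∈ S) → S ≈ˢ S′
⊆⊇⇒≈ˢ ⊆ ⊇ = mk≈ˢ (λ m → _ , ⊆ m , ≈-refl _) (λ m → _ , ⊇ m , ≈-refl _)

⇒-++ʳ : ∀ {n} {S S′ : Sum n} (X : Sum n) → S ⇒ S′ → (S ++ X) ⇒ (S′ ++ X)
⇒-++ʳ X (step A B {M} {𝕄} r) =
  subst₂ _⇒_ (sym (++-assoc A (M ∷ B) X))
             (≡-trans (cong (A ++_) (sym (++-assoc 𝕄 B X))) (sym (++-assoc A (𝕄 ++ B) X)))
             (step A (B ++ X) r)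

≈ˢ-++ʳ : ∀ {n} {S S′ : Sum n} (X : Sum n) → S ≈ˢ S′ → (S ++ X) ≈ˢ (S′ ++ X)
≈ˢ-++ʳ {S = S} {S′} X S≈S′ = mk≈ˢ fwd bwd
  where
  fwd : ∀ {M} → M ∈ S ++ X → ∃ λ M′ → M′ ∈ S′ ++ X × M ≈ M′
  fwd m with ∈-++⁻ S m
  ... | inj₁ m∈S = let _ , m′ , e = ≈ˢ-fwd S≈S′ m∈S in _ , ∈-++⁺ˡ m′ , e
  ... | inj₂ m∈X = _ , ∈-++⁺ʳ S′ m∈X , ≈-refl _
  bwd : ∀ {M′} → M′ ∈ S′ ++ X → ∃ λ M → M ∈ S ++ X × M ≈ M′
  bwd m with ∈-++⁻ S′ m
  ... | inj₁ m∈S′ = let _ , m′ , e = ≈ˢ-bwd S≈S′ m∈S′ in _ , ∈-++⁺ˡ m′ , e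
  ... | inj₂ m∈X  = _ , ∈-++⁺ʳ S m∈X , ≈-refl _

↠-++ʳ : ∀ {n} {S S′ : Sum n} (X : Sum n) → S ↠ S′ → (S ++ X) ↠ (S′ ++ X)
↠-++ʳ X ε                = ε
↠-++ʳ X (inj₁ s ◅ rs)    = inj₁ (⇒-++ʳ X s) ◅ ↠-++ʳ X rs
↠-++ʳ X (inj₂ S≈ ◅ rs)   = inj₂ (≈ˢ-++ʳ X S≈) ◅ ↠-++ʳ X rs

_⟶∋_ : ∀ {n} → Term n → Term n → Set
A ⟶∋ B = ∃ λ 𝕌 → A ⟶ 𝕌 × B ∈ 𝕌

_⟶∋ᵇ_ : ∀ {n} → Bag n → Bag n → Set
P ⟶∋ᵇ Q = ∃ λ ℚ → P ⟶ᵇ ℚ × Q ∈ ℚ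

_↠∋_ : ∀ {n} → Term n → Term n → Set
A ↠∋ B = ∃ λ 𝕄 → (A ∷ []) ↠ (B ∷ 𝕄)

↠∋-refl : ∀ {n} (A : Term n) → A ↠∋ A
↠∋-refl A = [] , ε

≈⇒↠∋ : ∀ {n} {A B : Term n} → A ≈ B → A ↠∋ B
≈⇒↠∋ A≈B = [] , inj₂ ((here A≈B All.∷ All.[]) , (here A≈B All.∷ All.[])) ◅ ε

⟶∋⇒↠∋ : ∀ {n} {A B : Term n} → A ⟶∋ B → A ↠∋ B
⟶∋⇒↠∋ {B = B} (𝕌 , r , B∈𝕌) = 𝕌 , inj₁ (step [] [] r) ◅ inj₂ (⊆⊇⇒≈ˢ ⊆ ⊇) ◅ ε
  where
  ⊆ : ∀ {M} → M ∈ 𝕌 ++ [] → M ∈ B ∷ 𝕌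
  ⊆ rewrite ++-identityʳ 𝕌 = there
  ⊇ : ∀ {M} → M ∈ B ∷ 𝕌 → M ∈ 𝕌 ++ []
  ⊇ (here refl) = ∈-++⁺ˡ B∈𝕌
  ⊇ (there m)   = ∈-++⁺ˡ m

↠∋-trans : ∀ {n} {A B C : Term n} → A ↠∋ B → B ↠∋ C → A ↠∋ C
↠∋-trans (𝕄 , A↠) (𝕄′ , B↠) = 𝕄′ ++ 𝕄 , A↠ ◅◅ ↠-++ʳ 𝕄 B↠

↠∋-summand : ∀ {n} {S : Sum n} {A B} → A ∈ S → A ↠∋ B → ∃ λ 𝕄 → S ↠ (B ∷ 𝕄)
↠∋-summand {S = S} {A} A∈S (𝕄 , A↠) = 𝕄 ++ S , inj₂ (⊆⊇⇒≈ˢ there ⊇) ◅ ↠-++ʳ S A↠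
  where
  ⊇ : ∀ {M} → M ∈ A ∷ S → M ∈ S
  ⊇ (here refl) = A∈S
  ⊇ (there m)   = m

module Congruence {n m} (F : Term n → Term m) (F-⟶ : ∀ {M 𝕄} → M ⟶ 𝕄 → F M ⟶ map F 𝕄)
                  (F-≈ : ∀ {M M′} → M ≈ M′ → F M ≈ F M′) where

  ⇒-map : ∀ {S S′} → S ⇒ S′ → map F S ⇒ map F S′
  ⇒-map (step A B {M} {𝕄} r) =
    subst₂ _⇒_ (sym (map-++ F A (M ∷ B)))
               (≡-trans (cong (map F A ++_) (sym (map-++ F 𝕄 B))) (sym (map-++ F A (𝕄 ++ B))))
               (step (map F A) (map F B) (F-⟶ r))

  ≈ˢ-map : ∀ {S S′} → S ≈ˢ S′ → map F S ≈ˢ map F S′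
  ≈ˢ-map {S} {S′} S≈S′ = mk≈ˢ fwd bwd
    where
    fwd : ∀ {M} → M ∈ map F S → ∃ λ M′ → M′ ∈ map F S′ × M ≈ M′
    fwd m with ∈-map⁻ F m
    ... | _ , m₀ , refl = let _ , m′ , e = ≈ˢ-fwd S≈S′ m₀ in _ , ∈-map⁺ F m′ , F-≈ e
    bwd : ∀ {M′} → M′ ∈ map F S′ → ∃ λ M → M ∈ map F S × M ≈ M′
    bwd m with ∈-map⁻ F m
    ... | _ , m₀ , refl = let _ , m′ , e = ≈ˢ-bwd S≈S′ m₀ in _ , ∈-map⁺ F m′ , F-≈ e

  ↠-map : ∀ {S S′} → S ↠ S′ → map F S ↠ map F S′
  ↠-map ε              = ε
  ↠-map (inj₁ s ◅ rs)  = inj₁ (⇒-map s) ◅ ↠-map rs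
  ↠-map (inj₂ S≈ ◅ rs) = inj₂ (≈ˢ-map S≈) ◅ ↠-map rs

  ↠∋-map : ∀ {A B} → A ↠∋ B → F A ↠∋ F B
  ↠∋-map (𝕄 , A↠) = map F 𝕄 , ↠-map A↠

↠∋-appL : ∀ {n} {A B : Term n} (P : Bag n) → A ↠∋ B → app A P ↠∋ app B P
↠∋-appL P = Congruence.↠∋-map (λ M → app M P) appL (λ e → app e (≈ᵇ-refl P))

↠∋-apps : ∀ {n} {A B : Term n} (Ps : List (Bag 0)) → A ↠∋ B → apps A Ps ↠∋ apps B Ps
↠∋-apps []       A↠B = A↠B
↠∋-apps (P ∷ Ps) A↠B = ↠∋-apps Ps (↠∋-appL (map wk0 P) A↠B)

_⟶∋*_ : ∀ {n} → Term n → Term n → Set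
_⟶∋*_ = Star (λ A B → A ⟶∋ B ⊎ A ≈ B)

↠-origin : ∀ {n} {S S′ : Sum n} → S ↠ S′ → ∀ {N} → N ∈ S′ → ∃ λ A → A ∈ S × A ⟶∋* N
↠-origin ε {N} N∈S = N , N∈S , ε
↠-origin (inj₁ (step A B {M} {𝕄} r) ◅ rs) N∈ with ↠-origin rs N∈
... | A₁ , A₁∈ , path with ∈-++⁻ A A₁∈
...   | inj₁ A₁∈A = A₁ , ∈-++⁺ˡ A₁∈A , path
...   | inj₂ A₁∈𝕄B with ∈-++⁻ 𝕄 A₁∈𝕄B
...     | inj₁ A₁∈𝕄 = M , ∈-++⁺ʳ A (here refl) , inj₁ (𝕄 , r , A₁∈𝕄) ◅ path
...     | inj₂ A₁∈B = A₁ , ∈-++⁺ʳ A (there A₁∈B) , path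
↠-origin (inj₂ S≈ ◅ rs) N∈ with ↠-origin rs N∈
... | A₁ , A₁∈ , path = let A₀ , A₀∈ , A₀≈A₁ = ≈ˢ-bwd S≈ A₁∈ in A₀ , A₀∈ , inj₂ A₀≈A₁ ◅ path

-- Linear substitution

++↭[] : ∀ {A : Set} {xs ys : List A} → xs ++ ys ↭ [] → xs ≡ [] × ys ≡ []
++↭[] {xs = xs} {ys} p = ++-conicalˡ xs ys (↭-empty-inv p) , ++-conicalʳ xs ys (↭-empty-inv p)

∷↭[] : ∀ {A : Set} {x : A} {xs} → ¬ (x ∷ xs ↭ [])
∷↭[] p with ↭-empty-inv p
... | ()

map↭[] : ∀ {A B : Set} {g : A → B} (xs : List A) → map g xs ↭ [] → xs ↭ []
map↭[] []      p = ↭-refl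
map↭[] (x ∷ xs) p = ⊥-elim (∷↭[] p)

↭-locate : ∀ {A : Set} {X R b₁ b₂ : List A} {c : A} → X ↭ c ∷ R → X ↭ b₁ ++ b₂ →
           (∃ λ R₁ → b₁ ↭ c ∷ R₁ × R ↭ R₁ ++ b₂) ⊎ (∃ λ R₂ → b₂ ↭ c ∷ R₂ × R ↭ b₁ ++ R₂)
↭-locate {R = R} {b₁} {b₂} {c} X↭cR X↭b with ∈-++⁻ b₁ (∈-resp-↭ (↭-trans (↭-sym X↭cR) X↭b) (here refl))
... | inj₁ c∈b₁ with ∈-∃++ c∈b₁
...   | ys , zs , refl = inj₁ (ys ++ zs , ↭-shift c ys zs , drop-∷ (begin
        c ∷ R                  ↭⟨ ↭-sym X↭cR ⟩
        _                      ↭⟨ X↭b ⟩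
        (ys ++ c ∷ zs) ++ b₂   ≡⟨ ++-assoc ys (c ∷ zs) b₂ ⟩
        ys ++ c ∷ zs ++ b₂     ↭⟨ ↭-shift c ys (zs ++ b₂) ⟩
        c ∷ ys ++ zs ++ b₂     ≡⟨ cong (c ∷_) (sym (++-assoc ys zs b₂)) ⟩
        c ∷ (ys ++ zs) ++ b₂   ∎))
  where open ↭.PermutationReasoning
↭-locate {R = R} {b₁} {b₂} {c} X↭cR X↭b | inj₂ c∈b₂ with ∈-∃++ c∈b₂
...   | ys , zs , refl = inj₂ (ys ++ zs , ↭-shift c ys zs , drop-∷ (begin
        c ∷ R                  ↭⟨ ↭-sym X↭cR ⟩
        _                      ↭⟨ X↭b ⟩
        b₁ ++ ys ++ c ∷ zs     ↭⟨ ++⁺ˡ b₁ (↭-shift c ys zs) ⟩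
        b₁ ++ c ∷ ys ++ zs     ↭⟨ ↭-shift c b₁ (ys ++ zs) ⟩
        c ∷ b₁ ++ ys ++ zs     ∎))
  where open ↭.PermutationReasoning

lsub-self : ∀ {n} (x : Fin n) (N : Term n) → N ∈ lsub x N (var x)
lsub-self x N with x ≟ x
... | yes _  = here refl
... | no x≢x = ⊥-elim (x≢x refl)

lsub-var-inv : ∀ {n} {x y : Fin n} {N A} → A ∈ lsub x N (var y) → y ≡ x × A ≡ N
lsub-var-inv {x = x} {y} m with y ≟ x
lsub-var-inv (here refl) | yes y≡x = y≡x , refl
lsub-var-inv ()          | no _

∈-lsubS⁺ : ∀ {n} {x : Fin n} {N A A₁ S} → A ∈ S → A₁ ∈ lsub x N A → A₁ ∈ lsubS x N S
∈-lsubS⁺ {x = x} {N} A∈S A₁∈ = ∈-concatMap⁺ (lsub x N) (lose A∈S A₁∈)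

∈-lsubS⁻ : ∀ {n} {x : Fin n} {N A₁} S → A₁ ∈ lsubS x N S → ∃ λ A → A ∈ S × A₁ ∈ lsub x N A
∈-lsubS⁻ {x = x} {N} S A₁∈ = find (∈-concatMap⁻ (lsub x N) {xs = S} A₁∈)

∈-eraseS⁺ : ∀ {n k} {f : Fin n → Maybe (Fin k)} {A B S} → A ∈ S → erase f A ≡ just B → B ∈ eraseS f S
∈-eraseS⁺ {f = f} {A} {B} A∈S e =
  ∈-concatMap⁺ (maybeToSum ∘ erase f) (lose A∈S (subst (λ o → B ∈ maybeToSum o) (sym e) (here refl)))

∈-eraseS⁻ : ∀ {n k} {f : Fin n → Maybe (Fin k)} {B} S → B ∈ eraseS f S → ∃ λ A → A ∈ S × erase f A ≡ just B
∈-eraseS⁻ {f = f} {B} S B∈ with find (∈-concatMap⁻ (maybeToSum ∘ erase f) {xs = S} B∈)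
... | A , A∈S , B∈′ = A , A∈S , ∈-maybeToSum (erase f A) B∈′
  where
  ∈-maybeToSum : ∀ o → B ∈ maybeToSum o → o ≡ just B
  ∈-maybeToSum (just _) (here refl) = refl

-- Lin f x R A B: B arises from A by replacing the occurrences of x by the
-- elements of the multiset R, one each, and erasing the other variables
-- along f.  Its instance Lin pop zero P describes the summands of a β-redex.
data Lin  : ∀ {m k} → (Fin m → Maybe (Fin k)) → Fin m → List (Term k) → Term m → Term k → Set
data Linᵇ : ∀ {m k} → (Fin m → Maybe (Fin k)) → Fin m → List (Term k) → Bag m → Bag k → Set

data Lin where
  keptₗ : ∀ {m k} {f : Fin m → Maybe (Fin k)} {x R i j} → f i ≡ just j → R ↭ [] → Lin f x R (var i) (var j)
  resₗ  : ∀ {m k} {f : Fin m → Maybe (Fin k)} {x R t} → R ↭ t ∷ [] → Lin f x R (var x) t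
  lamₗ  : ∀ {m k} {f : Fin m → Maybe (Fin k)} {x R M M′} →
          Lin (extᵐ f) (suc x) (map shift R) M M′ → Lin f x R (lam M) (lam M′)
  appₗ  : ∀ {m k} {f : Fin m → Maybe (Fin k)} {x R R₁ R₂ M M′ P P′} →
          R ↭ R₁ ++ R₂ → Lin f x R₁ M M′ → Linᵇ f x R₂ P P′ → Lin f x R (app M P) (app M′ P′)

data Linᵇ where
  nilₗ  : ∀ {m k} {f : Fin m → Maybe (Fin k)} {x R} → R ↭ [] → Linᵇ f x R [] []
  consₗ : ∀ {m k} {f : Fin m → Maybe (Fin k)} {x R R₁ R₂ L L′ P P′} →
          R ↭ R₁ ++ R₂ → Lin f x R₁ L L′ → Linᵇ f x R₂ P P′ → Linᵇ f x R (L ∷ P) (L′ ∷ P′)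

Lin-resp-↭ : ∀ {m k} {f : Fin m → Maybe (Fin k)} {x R R′ A B} → R ↭ R′ → Lin f x R A B → Lin f x R′ A B
Lin-resp-↭ p (keptₗ fi q)  = keptₗ fi (↭-trans (↭-sym p) q)
Lin-resp-↭ p (resₗ q)      = resₗ (↭-trans (↭-sym p) q)
Lin-resp-↭ p (lamₗ l)      = lamₗ (Lin-resp-↭ (↭-map⁺ shift p) l)
Lin-resp-↭ p (appₗ q l lᵇ) = appₗ (↭-trans (↭-sym p) q) l lᵇ

erase⇒Lin  : ∀ {m k} {f : Fin m → Maybe (Fin k)} {x} (A : Term m) {B} → erase f A ≡ just B → Lin f x [] A B
eraseᵇ⇒Linᵇ : ∀ {m k} {f : Fin m → Maybe (Fin k)} {x} (P : Bag m) {B} → eraseᵇ f P ≡ just B → Linᵇ f x [] P B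
erase⇒Lin {f = f} (var i) e with erase-var-inv f i e
... | _ , fi , refl = keptₗ fi ↭-refl
erase⇒Lin {f = f} (lam A) e with erase-lam-inv f A e
... | _ , eA , refl = lamₗ (erase⇒Lin A eA)
erase⇒Lin {f = f} (app A P) e with erase-app-inv f A P e
... | _ , _ , eA , eP , refl = appₗ ↭-refl (erase⇒Lin A eA) (eraseᵇ⇒Linᵇ P eP)
eraseᵇ⇒Linᵇ [] refl = nilₗ ↭-refl
eraseᵇ⇒Linᵇ {f = f} (L ∷ P) e with eraseᵇ-∷-inv f L P e
... | _ , _ , eL , eP , refl = consₗ ↭-refl (erase⇒Lin L eL) (eraseᵇ⇒Linᵇ P eP)

Lin⇒erase  : ∀ {m k} {f : Fin m → Maybe (Fin k)} {x R A B} → Lin f x R A B → R ↭ [] → erase f A ≡ just B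
Linᵇ⇒eraseᵇ : ∀ {m k} {f : Fin m → Maybe (Fin k)} {x R A B} → Linᵇ f x R A B → R ↭ [] → eraseᵇ f A ≡ just B
Lin⇒erase (keptₗ fi q) p rewrite fi = refl
Lin⇒erase (resₗ q) p = ⊥-elim (∷↭[] (↭-trans (↭-sym q) p))
Lin⇒erase (lamₗ {M = M} l) p =
  erase-lam-just _ M (Lin⇒erase l (↭-reflexive (cong (map shift) (↭-empty-inv p))))
Lin⇒erase (appₗ {R₁ = R₁} {R₂} {M = M} {P = P} q l lᵇ) p with ++↭[] {xs = R₁} {R₂} (↭-trans (↭-sym q) p)
... | refl , refl = erase-app-just _ M P (Lin⇒erase l ↭-refl) (Linᵇ⇒eraseᵇ lᵇ ↭-refl)
Linᵇ⇒eraseᵇ (nilₗ q) p = refl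
Linᵇ⇒eraseᵇ (consₗ {R₁ = R₁} {R₂} {L = L} {P = P} q l lᵇ) p with ++↭[] {xs = R₁} {R₂} (↭-trans (↭-sym q) p)
... | refl , refl = eraseᵇ-∷-just _ L P (Lin⇒erase l ↭-refl) (Linᵇ⇒eraseᵇ lᵇ ↭-refl)

Lin-wk0 : ∀ {m k} {f : Fin m → Maybe (Fin k)} {x} (c : Term 0) → Lin f x [] (wk0 c) (wk0 c)
Lin-wk0 {f = f} c = erase⇒Lin (wk0 c) (erase-wk0 f c)

Linᵇ-wk0 : ∀ {m k} {f : Fin m → Maybe (Fin k)} {x} (P : Bag 0) → Linᵇ f x [] (map wk0 P) (map wk0 P)
Linᵇ-wk0 []      = nilₗ ↭-refl
Linᵇ-wk0 (L ∷ P) = consₗ ↭-refl (Lin-wk0 L) (Linᵇ-wk0 P)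

-- A term surviving the erasure of x contains no x, hence consumes no resource.
erase⇒Lin-unique  : ∀ {m k} {f : Fin m → Maybe (Fin k)} {x R N B B₀} → f x ≡ nothing →
                    erase f N ≡ just B₀ → Lin f x R N B → R ↭ [] × B ≡ B₀
eraseᵇ⇒Linᵇ-unique : ∀ {m k} {f : Fin m → Maybe (Fin k)} {x R N B B₀} → f x ≡ nothing →
                    eraseᵇ f N ≡ just B₀ → Linᵇ f x R N B → R ↭ [] × B ≡ B₀
erase⇒Lin-unique {f = f} fx e (keptₗ {i = i} fi q) with erase-var-inv f i e
... | _ , fi′ , refl with ≡-trans (sym fi) fi′
... | refl = q , refl
erase⇒Lin-unique {f = f} {x} fx e (resₗ q) with erase-var-inv f x e
... | _ , fx′ , refl with ≡-trans (sym fx) fx′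
... | ()
erase⇒Lin-unique {f = f} {R = R} fx e (lamₗ {M = M} l) with erase-lam-inv f M e
... | _ , eM , refl with erase⇒Lin-unique (cong (Maybe.map suc) fx) eM l
... | p , refl = map↭[] R p , refl
erase⇒Lin-unique {f = f} fx e (appₗ {M = M} {P = P} q l lᵇ) with erase-app-inv f M P e
... | _ , _ , eM , eP , refl with erase⇒Lin-unique fx eM l | eraseᵇ⇒Linᵇ-unique fx eP lᵇ
... | p₁ , refl | p₂ , refl = ↭-trans q (++⁺ p₁ p₂) , refl
eraseᵇ⇒Linᵇ-unique fx refl (nilₗ q) = q , refl
eraseᵇ⇒Linᵇ-unique {f = f} fx e (consₗ {L = L} {P = P} q l lᵇ) with eraseᵇ-∷-inv f L P e
... | _ , _ , eL , eP , refl with erase⇒Lin-unique fx eL l | eraseᵇ⇒Linᵇ-unique fx eP lᵇ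
... | p₁ , refl | p₂ , refl = ↭-trans q (++⁺ p₁ p₂) , refl

-- Consuming one resource L = N{f} of x is one linear substitution ⟨N/x⟩.
Lin-∷⇒lsub  : ∀ {m k} {f : Fin m → Maybe (Fin k)} {x R L R′ A B} (N : Term m) → Lin f x R A B →
              R ↭ L ∷ R′ → erase f N ≡ just L → ∃ λ A₁ → A₁ ∈ lsub x N A × Lin f x R′ A₁ B
Linᵇ-∷⇒lsubᵇ : ∀ {m k} {f : Fin m → Maybe (Fin k)} {x R L R′ A B} (N : Term m) → Linᵇ f x R A B →
              R ↭ L ∷ R′ → erase f N ≡ just L → ∃ λ A₁ → A₁ ∈ lsubᵇ x N A × Linᵇ f x R′ A₁ B
Lin-∷⇒lsub N (keptₗ _ q) p eN = ⊥-elim (∷↭[] (↭-trans (↭-sym p) q))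
Lin-∷⇒lsub {x = x} N (resₗ q) p eN with ↭-singleton-inv (↭-trans (↭-sym p) q)
... | refl = N , lsub-self x N , erase⇒Lin N eN
Lin-∷⇒lsub {f = f} N (lamₗ l) p eN with Lin-∷⇒lsub (shift N) l (↭-map⁺ shift p) (erase-extᵐ-shift f N eN)
... | A₁ , A₁∈ , l′ = lam A₁ , ∈-map⁺ lam A₁∈ , lamₗ l′
Lin-∷⇒lsub N (appₗ {P = P} q l lᵇ) p eN with ↭-locate p q
... | inj₁ (_ , p₁ , p′) with Lin-∷⇒lsub N l p₁ eN
...   | A₁ , A₁∈ , l′ = app A₁ P , ∈-++⁺ˡ (∈-map⁺ (λ M′ → app M′ P) A₁∈) , appₗ p′ l′ lᵇ
Lin-∷⇒lsub {x = x} N (appₗ {M = M} {P = P} q l lᵇ) p eN | inj₂ (_ , p₂ , p′) with Linᵇ-∷⇒lsubᵇ N lᵇ p₂ eN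
...   | P₁ , P₁∈ , lᵇ′ = app M P₁ , ∈-++⁺ʳ (map (λ M′ → app M′ P) (lsub x N M)) (∈-map⁺ (app M) P₁∈) , appₗ p′ l lᵇ′
Linᵇ-∷⇒lsubᵇ N (nilₗ q) p eN = ⊥-elim (∷↭[] (↭-trans (↭-sym p) q))
Linᵇ-∷⇒lsubᵇ N (consₗ {P = P} q l lᵇ) p eN with ↭-locate p q
... | inj₁ (_ , p₁ , p′) with Lin-∷⇒lsub N l p₁ eN
...   | L₁ , L₁∈ , l′ = L₁ ∷ P , ∈-++⁺ˡ (∈-map⁺ (_∷ P) L₁∈) , consₗ p′ l′ lᵇ
Linᵇ-∷⇒lsubᵇ {x = x} N (consₗ {L = L} {P = P} q l lᵇ) p eN | inj₂ (_ , p₂ , p′) with Linᵇ-∷⇒lsubᵇ N lᵇ p₂ eN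
...   | P₁ , P₁∈ , lᵇ′ = L ∷ P₁ , ∈-++⁺ʳ (map (_∷ P) (lsub x N L)) (∈-map⁺ (L ∷_) P₁∈) , consₗ p′ l lᵇ′

lsub⇒Lin-∷  : ∀ {m k} {f : Fin m → Maybe (Fin k)} {x R N L A₁ B} → f x ≡ nothing → erase f N ≡ just L →
              (A : Term m) → A₁ ∈ lsub x N A → Lin f x R A₁ B → Lin f x (L ∷ R) A B
lsubᵇ⇒Linᵇ-∷ : ∀ {m k} {f : Fin m → Maybe (Fin k)} {x R N L A₁ B} → f x ≡ nothing → erase f N ≡ just L →
              (A : Bag m) → A₁ ∈ lsubᵇ x N A → Linᵇ f x R A₁ B → Linᵇ f x (L ∷ R) A B
lsub⇒Lin-∷ fx eN (var y) A₁∈ l with lsub-var-inv A₁∈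
... | refl , refl with erase⇒Lin-unique fx eN l
...   | p , refl = resₗ (↭-prep _ p)
lsub⇒Lin-∷ {f = f} {N = N} fx eN (lam M) A₁∈ l with ∈-map⁻ lam A₁∈
... | _ , M₁∈ , refl with l
...   | lamₗ l′ = lamₗ (lsub⇒Lin-∷ (cong (Maybe.map suc) fx) (erase-extᵐ-shift f N eN) M M₁∈ l′)
lsub⇒Lin-∷ {x = x} {N = N} fx eN (app M P) A₁∈ l with ∈-++⁻ (map (λ M′ → app M′ P) (lsub x N M)) A₁∈
... | inj₁ ∈ˡ with ∈-map⁻ (λ M′ → app M′ P) ∈ˡ
...   | _ , M₁∈ , refl with l
...     | appₗ q l′ lᵇ = appₗ (↭-prep _ q) (lsub⇒Lin-∷ fx eN M M₁∈ l′) lᵇ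
lsub⇒Lin-∷ fx eN (app M P) A₁∈ l | inj₂ ∈ʳ with ∈-map⁻ (app M) ∈ʳ
...   | _ , P₁∈ , refl with l
...     | appₗ {R₁ = R₁} {R₂} q l′ lᵇ =
          appₗ (↭-trans (↭-prep _ q) (↭-sym (↭-shift _ R₁ R₂))) l′ (lsubᵇ⇒Linᵇ-∷ fx eN P P₁∈ lᵇ)
lsubᵇ⇒Linᵇ-∷ fx eN [] () lᵇ
lsubᵇ⇒Linᵇ-∷ {x = x} {N = N} fx eN (L ∷ P) A₁∈ l with ∈-++⁻ (map (_∷ P) (lsub x N L)) A₁∈
... | inj₁ ∈ˡ with ∈-map⁻ (_∷ P) ∈ˡ
...   | _ , L₁∈ , refl with l
...     | consₗ q l′ lᵇ = consₗ (↭-prep _ q) (lsub⇒Lin-∷ fx eN L L₁∈ l′) lᵇ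
lsubᵇ⇒Linᵇ-∷ fx eN (L ∷ P) A₁∈ l | inj₂ ∈ʳ with ∈-map⁻ (L ∷_) ∈ʳ
...   | _ , P₁∈ , refl with l
...     | consₗ {R₁ = R₁} {R₂} q l′ lᵇ =
          consₗ (↭-trans (↭-prep _ q) (↭-sym (↭-shift _ R₁ R₂))) l′ (lsubᵇ⇒Linᵇ-∷ fx eN P P₁∈ lᵇ)

Lin⇒∈-bagSubS : ∀ {k} {u : Term k} (Q : Bag k) (S : Sum (suc k)) {A R} → A ∈ S → Lin pop zero R A u → R ↭ Q →
                u ∈ eraseS pop (bagSubS zero (map shift Q) S)
Lin⇒∈-bagSubS []      S A∈S l p = ∈-eraseS⁺ A∈S (Lin⇒erase l p)
Lin⇒∈-bagSubS (L ∷ Q) S A∈S l p with Lin-∷⇒lsub (shift L) l p (erase-pop-shift L)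
... | A₁ , A₁∈ , l′ = Lin⇒∈-bagSubS Q (lsubS zero (shift L) S) (∈-lsubS⁺ A∈S A₁∈) l′ ↭-refl

∈-bagSubS⇒Lin : ∀ {k} {B : Term k} (Q : Bag k) (S : Sum (suc k)) {C R} → C ∈ bagSubS zero (map shift Q) S →
                Lin pop zero R C B → ∃ λ A → A ∈ S × Lin pop zero (Q ++ R) A B
∈-bagSubS⇒Lin []      S C∈ l = _ , C∈ , l
∈-bagSubS⇒Lin (L ∷ Q) S C∈ l with ∈-bagSubS⇒Lin Q (lsubS zero (shift L) S) C∈ l
... | A₁ , A₁∈ , l₁ with ∈-lsubS⁻ S A₁∈
...   | A , A∈S , A₁∈′ = A , A∈S , lsub⇒Lin-∷ refl (erase-pop-shift L) A A₁∈′ l₁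

Lin⇒β-summand : ∀ {k} {M : Term (suc k)} {P u} → Lin pop zero P M u → app (lam M) P ⟶∋ u
Lin⇒β-summand {P = P} l = _ , β _ P , Lin⇒∈-bagSubS P _ (here refl) l ↭-refl

β-summand⇒Lin : ∀ {k} {M : Term (suc k)} {P B} → B ∈ eraseS pop (bagSubS zero (map shift P) (M ∷ [])) →
                Lin pop zero P M B
β-summand⇒Lin {M = M} {P} B∈ with ∈-eraseS⁻ (bagSubS zero (map shift P) (M ∷ [])) B∈
... | C , C∈ , eC with ∈-bagSubS⇒Lin P (M ∷ []) C∈ (erase⇒Lin {x = zero} C eC)
...   | _ , here refl , l = Lin-resp-↭ (↭-reflexive (++-identityʳ P)) l

-- Substitution of closed resources

-- For each variable: whether it survives (and as which variable) or is
-- erased, and the bag of closed terms to be substituted for it linearly.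
Env : ℕ → ℕ → Set
Env n k = Fin n → Maybe (Fin k) × Bag 0

keep : ∀ {n k} → Env n k → Fin n → Maybe (Fin k)
keep ρ i = proj₁ (ρ i)

bag : ∀ {n k} → Env n k → Fin n → Bag 0
bag ρ i = proj₂ (ρ i)

extE : ∀ {n k} → Env n k → Env (suc n) (suc k)
extE ρ zero    = just zero , []
extE ρ (suc i) = Maybe.map suc (keep ρ i) , bag ρ i

emptyE : ∀ {n k} → Env n k → Env n k
emptyE ρ i = keep ρ i , []

Empty : ∀ {n k} → Env n k → Set
Empty ρ = ∀ i → bag ρ i ≡ []

record Split {n k} (ρ ρ₁ ρ₂ : Env n k) : Set where
  constructor mkSplit
  field
    keepˡ : ∀ i → keep ρ₁ i ≡ keep ρ i
    keepʳ : ∀ i → keep ρ₂ i ≡ keep ρ i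
    bags  : ∀ i → bag ρ i ↭ bag ρ₁ i ++ bag ρ₂ i
open Split

-- Sub ρ A B: B is a summand of A⟨ρ⟩ with the variables erased by ρ replaced by 0.
data Sub  : ∀ {n k} → Env n k → Term n → Term k → Set
data Subᵇ : ∀ {n k} → Env n k → Bag n → Bag k → Set

data Sub where
  keptₛ : ∀ {n k} {ρ : Env n k} {i j} → keep ρ i ≡ just j → Empty ρ → Sub ρ (var i) (var j)
  resₛ  : ∀ {n k} {ρ : Env n k} {i t} → bag ρ i ↭ t ∷ [] → (∀ j → j ≢ i → bag ρ j ≡ []) → Sub ρ (var i) (wk0 t)
  lamₛ  : ∀ {n k} {ρ : Env n k} {M M′} → Sub (extE ρ) M M′ → Sub ρ (lam M) (lam M′)
  appₛ  : ∀ {n k} {ρ ρ₁ ρ₂ : Env n k} {M M′ P P′} →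
          Split ρ ρ₁ ρ₂ → Sub ρ₁ M M′ → Subᵇ ρ₂ P P′ → Sub ρ (app M P) (app M′ P′)

data Subᵇ where
  nilₛ  : ∀ {n k} {ρ : Env n k} → Empty ρ → Subᵇ ρ [] []
  consₛ : ∀ {n k} {ρ ρ₁ ρ₂ : Env n k} {L L′ P P′} →
          Split ρ ρ₁ ρ₂ → Sub ρ₁ L L′ → Subᵇ ρ₂ P P′ → Subᵇ ρ (L ∷ P) (L′ ∷ P′)

_≈E_ : ∀ {n k} → Env n k → Env n k → Set
ρ ≈E ρ′ = ∀ i → keep ρ i ≡ keep ρ′ i × bag ρ i ↭ bag ρ′ i

Empty-resp-≈E : ∀ {n k} {ρ ρ′ : Env n k} → ρ ≈E ρ′ → Empty ρ → Empty ρ′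
Empty-resp-≈E ρ≈ em i = ↭-empty-inv (↭-trans (↭-sym (proj₂ (ρ≈ i))) (↭-reflexive (em i)))

Split-resp-≈E : ∀ {n k} {ρ ρ′ ρ₁ ρ₂ : Env n k} → ρ ≈E ρ′ → Split ρ ρ₁ ρ₂ → Split ρ′ ρ₁ ρ₂
Split-resp-≈E ρ≈ sp = mkSplit (λ i → ≡-trans (keepˡ sp i) (proj₁ (ρ≈ i)))
                              (λ i → ≡-trans (keepʳ sp i) (proj₁ (ρ≈ i)))
                              (λ i → ↭-trans (↭-sym (proj₂ (ρ≈ i))) (bags sp i))

extE-resp-≈E : ∀ {n k} {ρ ρ′ : Env n k} → ρ ≈E ρ′ → extE ρ ≈E extE ρ′
extE-resp-≈E ρ≈ zero    = refl , ↭-refl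
extE-resp-≈E ρ≈ (suc i) = cong (Maybe.map suc) (proj₁ (ρ≈ i)) , proj₂ (ρ≈ i)

Sub-resp-≈E  : ∀ {n k} {ρ ρ′ : Env n k} {A B} → ρ ≈E ρ′ → Sub ρ A B → Sub ρ′ A B
Subᵇ-resp-≈E : ∀ {n k} {ρ ρ′ : Env n k} {A B} → ρ ≈E ρ′ → Subᵇ ρ A B → Subᵇ ρ′ A B
Sub-resp-≈E ρ≈ (keptₛ kj em) = keptₛ (≡-trans (sym (proj₁ (ρ≈ _))) kj) (Empty-resp-≈E ρ≈ em)
Sub-resp-≈E ρ≈ (resₛ {i = i} b others) =
  resₛ (↭-trans (↭-sym (proj₂ (ρ≈ i))) b)
       (λ j j≢i → ↭-empty-inv (↭-trans (↭-sym (proj₂ (ρ≈ j))) (↭-reflexive (others j j≢i))))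
Sub-resp-≈E ρ≈ (lamₛ s)        = lamₛ (Sub-resp-≈E (extE-resp-≈E ρ≈) s)
Sub-resp-≈E ρ≈ (appₛ sp s sᵇ)  = appₛ (Split-resp-≈E ρ≈ sp) s sᵇ
Subᵇ-resp-≈E ρ≈ (nilₛ em)        = nilₛ (Empty-resp-≈E ρ≈ em)
Subᵇ-resp-≈E ρ≈ (consₛ sp s sᵇ)  = consₛ (Split-resp-≈E ρ≈ sp) s sᵇ

split-all-left : ∀ {n k} (ρ : Env n k) → Split ρ ρ (emptyE ρ)
split-all-left ρ = mkSplit (λ _ → refl) (λ _ → refl) (λ i → ↭-reflexive (sym (++-identityʳ (bag ρ i))))

split-all-right : ∀ {n k} (ρ : Env n k) → Split ρ (emptyE ρ) ρ
split-all-right ρ = mkSplit (λ _ → refl) (λ _ → refl) (λ _ → ↭-refl)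

Empty-split : ∀ {n k} {ρ ρ₁ ρ₂ : Env n k} → Split ρ ρ₁ ρ₂ → Empty ρ → Empty ρ₁ × Empty ρ₂
Empty-split sp em = (λ i → proj₁ (split i)) , (λ i → proj₂ (split i))
  where split = λ i → ++↭[] (↭-trans (↭-sym (bags sp i)) (↭-reflexive (em i)))

Empty-extE : ∀ {n k} {ρ : Env n k} → Empty ρ → Empty (extE ρ)
Empty-extE em zero    = refl
Empty-extE em (suc i) = em i

Sub-ren  : ∀ {m n k} {ρ : Env n k} (g : Fin m → Fin n) (h : Fin m → Fin k) → Empty ρ →
           (∀ i → keep ρ (g i) ≡ just (h i)) → (c : Term m) → Sub ρ (ren g c) (ren h c)
Subᵇ-ren : ∀ {m n k} {ρ : Env n k} (g : Fin m → Fin n) (h : Fin m → Fin k) → Empty ρ →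
           (∀ i → keep ρ (g i) ≡ just (h i)) → (P : Bag m) → Subᵇ ρ (renᵇ g P) (renᵇ h P)
Sub-ren g h em gh (var i)   = keptₛ (gh i) em
Sub-ren g h em gh (lam c)   =
  lamₛ (Sub-ren (ext g) (ext h) (Empty-extE em) (λ { zero → refl ; (suc i) → cong (Maybe.map suc) (gh i) }) c)
Sub-ren {ρ = ρ} g h em gh (app c P) = appₛ (split-all-left ρ) (Sub-ren g h em gh c) (Subᵇ-ren g h (λ _ → refl) gh P)
Subᵇ-ren g h em gh []      = nilₛ em
Subᵇ-ren {ρ = ρ} g h em gh (L ∷ P) = consₛ (split-all-left ρ) (Sub-ren g h em gh L) (Subᵇ-ren g h (λ _ → refl) gh P)

Sub-wk0 : ∀ {n k} {ρ : Env n k} → Empty ρ → (c : Term 0) → Sub ρ (wk0 c) (wk0 c)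
Sub-wk0 em = Sub-ren (λ ()) (λ ()) em (λ ())

Subᵇ-wk0 : ∀ {n k} {ρ : Env n k} → Empty ρ → (P : Bag 0) → Subᵇ ρ (map wk0 P) (map wk0 P)
Subᵇ-wk0 em []      = nilₛ em
Subᵇ-wk0 {ρ = ρ} em (L ∷ P) = consₛ (split-all-left ρ) (Sub-wk0 em L) (Subᵇ-wk0 (λ _ → refl) P)

Sub-apps : ∀ {n k} {ρ : Env n k} {A B} (Ps : List (Bag 0)) → Sub ρ A B → Sub ρ (apps A Ps) (apps B Ps)
Sub-apps []       s = s
Sub-apps {ρ = ρ} (P ∷ Ps) s = Sub-apps Ps (appₛ (split-all-left ρ) s (Subᵇ-wk0 (λ _ → refl) P))

Sub⇒erase  : ∀ {n k} {ρ : Env n k} (g : Fin n → Maybe (Fin k)) → (∀ i → g i ≡ keep ρ i) →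
             ∀ {A B} → Sub ρ A B → Empty ρ → erase g A ≡ just B
Subᵇ⇒eraseᵇ : ∀ {n k} {ρ : Env n k} (g : Fin n → Maybe (Fin k)) → (∀ i → g i ≡ keep ρ i) →
             ∀ {A B} → Subᵇ ρ A B → Empty ρ → eraseᵇ g A ≡ just B
Sub⇒erase g g≗ (keptₛ {i = i} kj _) em rewrite g≗ i | kj = refl
Sub⇒erase g g≗ (resₛ {i = i} b _) em = ⊥-elim (∷↭[] (↭-trans (↭-sym b) (↭-reflexive (em i))))
Sub⇒erase g g≗ (lamₛ {M = M} s) em =
  erase-lam-just g M (Sub⇒erase (extᵐ g) (λ { zero → refl ; (suc i) → cong (Maybe.map suc) (g≗ i) }) s (Empty-extE em))
Sub⇒erase g g≗ (appₛ {M = M} {P = P} sp s sᵇ) em =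
  erase-app-just g M P (Sub⇒erase g (λ i → ≡-trans (g≗ i) (sym (keepˡ sp i))) s (proj₁ (Empty-split sp em)))
                       (Subᵇ⇒eraseᵇ g (λ i → ≡-trans (g≗ i) (sym (keepʳ sp i))) sᵇ (proj₂ (Empty-split sp em)))
Subᵇ⇒eraseᵇ g g≗ (nilₛ _) em = refl
Subᵇ⇒eraseᵇ g g≗ (consₛ {L = L} {P = P} sp s sᵇ) em =
  eraseᵇ-∷-just g L P (Sub⇒erase g (λ i → ≡-trans (g≗ i) (sym (keepˡ sp i))) s (proj₁ (Empty-split sp em)))
                      (Subᵇ⇒eraseᵇ g (λ i → ≡-trans (g≗ i) (sym (keepʳ sp i))) sᵇ (proj₂ (Empty-split sp em)))

mergeE : ∀ {n k} → Env n k → Env n k → Env n k → Env n k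
mergeE ρ ρ₁ ρ₂ i = keep ρ i , bag ρ₁ i ++ bag ρ₂ i

Split-mergeE : ∀ {n k} (ρ : Env n k) {ρ₁ ρ₂ : Env n k} → (∀ i → keep ρ₁ i ≡ keep ρ i) → (∀ i → keep ρ₂ i ≡ keep ρ i) →
               Split (mergeE ρ ρ₁ ρ₂) ρ₁ ρ₂
Split-mergeE ρ k₁ k₂ = mkSplit k₁ k₂ (λ _ → ↭-refl)

record Update {n k} (ρ ρ′ : Env n k) (x : Fin n) (R : Bag 0) : Set where
  constructor mkUpdate
  field
    keep-same : ∀ i → keep ρ′ i ≡ keep ρ i
    bag-at    : bag ρ′ x ↭ R
    bag-else  : ∀ i → i ≢ x → bag ρ′ i ↭ bag ρ i
open Update

Update-left : ∀ {n k} {ρ ρ₁ ρ₂ ρ₁′ : Env n k} {x R R₁} → Split ρ ρ₁ ρ₂ → R ↭ R₁ ++ bag ρ₂ x →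
              Update ρ₁ ρ₁′ x R₁ → Split (mergeE ρ ρ₁′ ρ₂) ρ₁′ ρ₂ × Update ρ (mergeE ρ ρ₁′ ρ₂) x R
Update-left {ρ = ρ} {ρ₂ = ρ₂} sp p u =
  Split-mergeE ρ (λ i → ≡-trans (keep-same u i) (keepˡ sp i)) (keepʳ sp) ,
  mkUpdate (λ _ → refl) (↭-trans (++⁺ʳ _ (bag-at u)) (↭-sym p))
           (λ i i≢x → ↭-trans (++⁺ʳ (bag ρ₂ i) (bag-else u i i≢x)) (↭-sym (bags sp i)))

Update-right : ∀ {n k} {ρ ρ₁ ρ₂ ρ₂′ : Env n k} {x R R₂} → Split ρ ρ₁ ρ₂ → R ↭ bag ρ₁ x ++ R₂ →
               Update ρ₂ ρ₂′ x R₂ → Split (mergeE ρ ρ₁ ρ₂′) ρ₁ ρ₂′ × Update ρ (mergeE ρ ρ₁ ρ₂′) x R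
Update-right {ρ = ρ} {ρ₁ = ρ₁} sp p u =
  Split-mergeE ρ (keepˡ sp) (λ i → ≡-trans (keep-same u i) (keepʳ sp i)) ,
  mkUpdate (λ _ → refl) (↭-trans (++⁺ˡ (bag ρ₁ _) (bag-at u)) (↭-sym p))
           (λ i i≢x → ↭-trans (++⁺ˡ (bag ρ₁ i) (bag-else u i i≢x)) (↭-sym (bags sp i)))

suc-≢ : ∀ {n} {i x : Fin n} → i ≢ x → Fin.suc i ≢ suc x
suc-≢ i≢x refl = i≢x refl

-- Consuming one closed resource c of x is one linear substitution ⟨c/x⟩.
Sub-∷⇒lsub  : ∀ {n k} {ρ : Env n k} {x c R A t} → Sub ρ A t → bag ρ x ↭ c ∷ R →
              ∃ λ A₁ → ∃ λ ρ′ → A₁ ∈ lsub x (wk0 c) A × Sub ρ′ A₁ t × Update ρ ρ′ x R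
Subᵇ-∷⇒lsubᵇ : ∀ {n k} {ρ : Env n k} {x c R A t} → Subᵇ ρ A t → bag ρ x ↭ c ∷ R →
              ∃ λ A₁ → ∃ λ ρ′ → A₁ ∈ lsubᵇ x (wk0 c) A × Subᵇ ρ′ A₁ t × Update ρ ρ′ x R
Sub-∷⇒lsub {x = x} (keptₛ _ em) p = ⊥-elim (∷↭[] (↭-trans (↭-sym p) (↭-reflexive (em x))))
Sub-∷⇒lsub {ρ = ρ} {x} {c} (resₛ {i = i} b others) p with x ≟ i
... | no x≢i = ⊥-elim (∷↭[] (↭-trans (↭-sym p) (↭-reflexive (others x x≢i))))
... | yes refl with ↭-singleton-inv (↭-trans (↭-sym p) b)
...   | refl = wk0 c , emptyE ρ , lsub-self x (wk0 c) , Sub-wk0 (λ _ → refl) c ,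
               mkUpdate (λ _ → refl) ↭-refl (λ j j≢x → ↭-sym (↭-reflexive (others j j≢x)))
Sub-∷⇒lsub {ρ = ρ} {x} {c} (lamₛ {M = M} s) p with Sub-∷⇒lsub {x = suc x} s p
... | A₁ , ρ* , A₁∈ , s′ , u =
  lam A₁ , ρ′ , ∈-map⁺ lam (subst (λ N → A₁ ∈ lsub (suc x) N M) (sym (ren-wk0 suc c)) A₁∈) ,
  lamₛ (Sub-resp-≈E ρ*≈ s′) , mkUpdate (λ _ → refl) (bag-at u) (λ i i≢x → bag-else u (suc i) (suc-≢ i≢x))
  where
  ρ′ : Env _ _
  ρ′ i = keep ρ i , bag ρ* (suc i)
  ρ*≈ : ρ* ≈E extE ρ′
  ρ*≈ zero    = keep-same u zero , bag-else u zero (λ ())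
  ρ*≈ (suc i) = keep-same u (suc i) , ↭-refl
Sub-∷⇒lsub {x = x} (appₛ sp s sᵇ) p with ↭-locate p (bags sp x)
... | inj₁ (_ , p₁ , p′) with Sub-∷⇒lsub s p₁
...   | A₁ , _ , A₁∈ , s′ , u = let sp′ , u′ = Update-left sp p′ u in
        app A₁ _ , _ , ∈-++⁺ˡ (∈-map⁺ _ A₁∈) , appₛ sp′ s′ sᵇ , u′
Sub-∷⇒lsub {x = x} {c} (appₛ {M = M} {P = P} sp s sᵇ) p | inj₂ (_ , p₂ , p′) with Subᵇ-∷⇒lsubᵇ sᵇ p₂
...   | P₁ , _ , P₁∈ , sᵇ′ , u = let sp′ , u′ = Update-right sp p′ u in
        app M P₁ , _ , ∈-++⁺ʳ (map (λ M′ → app M′ P) (lsub x (wk0 c) M)) (∈-map⁺ (app M) P₁∈) , appₛ sp′ s sᵇ′ , u′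
Subᵇ-∷⇒lsubᵇ {x = x} (nilₛ em) p = ⊥-elim (∷↭[] (↭-trans (↭-sym p) (↭-reflexive (em x))))
Subᵇ-∷⇒lsubᵇ {x = x} (consₛ {P = P} sp s sᵇ) p with ↭-locate p (bags sp x)
... | inj₁ (_ , p₁ , p′) with Sub-∷⇒lsub s p₁
...   | L₁ , _ , L₁∈ , s′ , u = let sp′ , u′ = Update-left sp p′ u in
        L₁ ∷ P , _ , ∈-++⁺ˡ (∈-map⁺ (_∷ P) L₁∈) , consₛ sp′ s′ sᵇ , u′
Subᵇ-∷⇒lsubᵇ {x = x} {c} (consₛ {L = L} {P = P} sp s sᵇ) p | inj₂ (_ , p₂ , p′) with Subᵇ-∷⇒lsubᵇ sᵇ p₂
...   | P₁ , _ , P₁∈ , sᵇ′ , u = let sp′ , u′ = Update-right sp p′ u in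
        L ∷ P₁ , _ , ∈-++⁺ʳ (map (_∷ P) (lsub x (wk0 c) L)) (∈-map⁺ (L ∷_) P₁∈) , consₛ sp′ s sᵇ′ , u′

Sub⇒∈-bagSubS : ∀ {n k} (Q : Bag 0) {x : Fin n} {S A} {ρ : Env n k} {t} → A ∈ S → Sub ρ A t → bag ρ x ↭ Q →
                ∃ λ A′ → ∃ λ ρ′ → A′ ∈ bagSubS x (map wk0 Q) S × Sub ρ′ A′ t × Update ρ ρ′ x []
Sub⇒∈-bagSubS []      {ρ = ρ} A∈ s p = _ , ρ , A∈ , s , mkUpdate (λ _ → refl) p (λ _ _ → ↭-refl)
Sub⇒∈-bagSubS (c ∷ Q) A∈ s p with Sub-∷⇒lsub s p
... | A₁ , ρ₁ , A₁∈ , s₁ , u₁ with Sub⇒∈-bagSubS Q (∈-lsubS⁺ A∈ A₁∈) s₁ (bag-at u₁)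
...   | A′ , ρ′ , A′∈ , s′ , u′ =
        A′ , ρ′ , A′∈ , s′ , mkUpdate (λ i → ≡-trans (keep-same u′ i) (keep-same u₁ i)) (bag-at u′)
                                      (λ i i≢x → ↭-trans (bag-else u′ i i≢x) (bag-else u₁ i i≢x))

Sub⇒∈-substVars : ∀ {n} (P′ : Fin n → Bag 0) (xs : List (Fin n)) → Unique xs → ∀ {S A} {ρ : Env n 0} {t} →
                  A ∈ S → Sub ρ A t → (∀ i → keep ρ i ≡ nothing) →
                  (∀ i → i ∈ xs → bag ρ i ↭ P′ i) → (∀ i → ¬ (i ∈ xs) → bag ρ i ↭ []) →
                  t ∈ eraseS allZero (foldl (λ acc i → bagSubS i (map wk0 (P′ i)) acc) S xs)
Sub⇒∈-substVars P′ [] _ A∈ s erased inxs outxs =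
  ∈-eraseS⁺ A∈ (Sub⇒erase allZero (λ i → sym (erased i)) s (λ i → ↭-empty-inv (outxs i (λ ()))))
Sub⇒∈-substVars P′ (x ∷ xs) (x∉xs ∷ uniq) {ρ = ρ} A∈ s erased inxs outxs
  with Sub⇒∈-bagSubS (P′ x) A∈ s (inxs x (here refl))
... | A′ , ρ′ , A′∈ , s′ , u =
  Sub⇒∈-substVars P′ xs uniq A′∈ s′ (λ i → ≡-trans (keep-same u i) (erased i)) inxs′ outxs′
  where
  inxs′ : ∀ i → i ∈ xs → bag ρ′ i ↭ P′ i
  inxs′ i i∈ = ↭-trans (bag-else u i (λ { refl → All.lookup x∉xs i∈ refl })) (inxs i (there i∈))
  outxs′ : ∀ i → ¬ (i ∈ xs) → bag ρ′ i ↭ []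
  outxs′ i i∉ with i ≟ x
  ... | yes refl = bag-at u
  ... | no i≢x   = ↭-trans (bag-else u i i≢x) (outxs i (λ { (here i≡x) → i≢x i≡x ; (there i∈) → i∉ i∈ }))

Sub⇒∈-multiSubS : ∀ {n} {ρ : Env n 0} {A t} → Sub ρ A t → (∀ i → keep ρ i ≡ nothing) →
                  t ∈ eraseS allZero (multiSubS (A ∷ []) (bag ρ))
Sub⇒∈-multiSubS {n} {ρ} s erased =
  Sub⇒∈-substVars (bag ρ) (allFin n) (allFin⁺ n) (here refl) s erased
                  (λ _ _ → ↭-refl) (λ i i∉ → ⊥-elim (i∉ (∈-allFin i)))

Split-rotate : ∀ {n k} {ρ ρ₁ ρ₂₃ ρ₂ ρ₃ : Env n k} → Split ρ ρ₁ ρ₂₃ → Split ρ₂₃ ρ₂ ρ₃ →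
               Split ρ ρ₂ (mergeE ρ ρ₁ ρ₃) × Split (mergeE ρ ρ₁ ρ₃) ρ₁ ρ₃
Split-rotate {ρ = ρ} {ρ₁ = ρ₁} {ρ₂ = ρ₂} sp₁ sp₂ =
  mkSplit (λ i → ≡-trans (keepˡ sp₂ i) (keepʳ sp₁ i)) (λ _ → refl)
          (λ i → ↭-trans (bags sp₁ i) (↭-trans (++⁺ˡ (bag ρ₁ i) (bags sp₂ i)) (shifts (bag ρ₁ i) (bag ρ₂ i)))) ,
  Split-mergeE ρ (keepˡ sp₁) (λ i → ≡-trans (keepʳ sp₂ i) (keepʳ sp₁ i))

Split-swap : ∀ {n k} {ρ ρ₁ ρ₂ : Env n k} → Split ρ ρ₁ ρ₂ → Split ρ ρ₂ ρ₁
Split-swap {ρ₁ = ρ₁} {ρ₂} sp = mkSplit (keepʳ sp) (keepˡ sp) (λ i → ↭-trans (bags sp i) (++-comm (bag ρ₁ i) (bag ρ₂ i)))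

Split-interchange : ∀ {n k} {ρ ρa ρb ρa₁ ρa₂ ρb₁ ρb₂ : Env n k} →
                    Split ρ ρa ρb → Split ρa ρa₁ ρa₂ → Split ρb ρb₁ ρb₂ →
                    Split ρ (mergeE ρ ρa₁ ρb₁) (mergeE ρ ρa₂ ρb₂) ×
                    Split (mergeE ρ ρa₁ ρb₁) ρa₁ ρb₁ × Split (mergeE ρ ρa₂ ρb₂) ρa₂ ρb₂
Split-interchange {ρ = ρ} {ρa₁ = ρa₁} {ρa₂} {ρb₁} {ρb₂} sp spa spb =
  mkSplit (λ _ → refl) (λ _ → refl)
          (λ i → ↭-trans (bags sp i) (↭-trans (++⁺ (bags spa i) (bags spb i)) (interchange i))) ,
  Split-mergeE ρ (λ i → ≡-trans (keepˡ spa i) (keepˡ sp i)) (λ i → ≡-trans (keepˡ spb i) (keepʳ sp i)) ,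
  Split-mergeE ρ (λ i → ≡-trans (keepʳ spa i) (keepˡ sp i)) (λ i → ≡-trans (keepʳ spb i) (keepʳ sp i))
  where
  interchange : ∀ i → (bag ρa₁ i ++ bag ρa₂ i) ++ (bag ρb₁ i ++ bag ρb₂ i) ↭
                      (bag ρa₁ i ++ bag ρb₁ i) ++ (bag ρa₂ i ++ bag ρb₂ i)
  interchange i = begin
    (a₁ ++ a₂) ++ (b₁ ++ b₂)   ≡⟨ ++-assoc a₁ a₂ (b₁ ++ b₂) ⟩
    a₁ ++ a₂ ++ b₁ ++ b₂       ↭⟨ ++⁺ˡ a₁ (shifts a₂ b₁) ⟩
    a₁ ++ b₁ ++ a₂ ++ b₂       ≡⟨ ++-assoc a₁ b₁ (a₂ ++ b₂) ⟨
    (a₁ ++ b₁) ++ (a₂ ++ b₂)   ∎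
    where
    open ↭.PermutationReasoning
    a₁ = bag ρa₁ i ; a₂ = bag ρa₂ i ; b₁ = bag ρb₁ i ; b₂ = bag ρb₂ i

Subᵇ-++ : ∀ {n k} {ρ ρ₁ ρ₂ : Env n k} {X X′ Y Y′} → Split ρ ρ₁ ρ₂ → Subᵇ ρ₁ X Y → Subᵇ ρ₂ X′ Y′ →
          Subᵇ ρ (X ++ X′) (Y ++ Y′)
Subᵇ-++ {ρ₂ = ρ₂} sp (nilₛ em) sᵇ₂ =
  Subᵇ-resp-≈E (λ i → keepʳ sp i , ↭-trans (↭-reflexive (cong (_++ bag ρ₂ i) (sym (em i)))) (↭-sym (bags sp i))) sᵇ₂
Subᵇ-++ sp (consₛ sp₁ s sᵇ) sᵇ₂ with Split-rotate (Split-swap sp) sp₁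
... | sp′ , sp″ = consₛ sp′ s (Subᵇ-++ (Split-swap sp″) sᵇ sᵇ₂)

Subᵇ-resp-↭ : ∀ {n k} {ρ : Env n k} {X X′ Y} → X ↭ X′ → Subᵇ ρ X Y → ∃ λ Y′ → Subᵇ ρ X′ Y′ × Y ↭ Y′
Subᵇ-resp-↭ ↭.refl sᵇ = _ , sᵇ , ↭-refl
Subᵇ-resp-↭ (↭.prep x p) (consₛ sp s sᵇ) with Subᵇ-resp-↭ p sᵇ
... | _ , sᵇ′ , q = _ , consₛ sp s sᵇ′ , ↭-prep _ q
Subᵇ-resp-↭ (↭.swap x y p) (consₛ sp₁ s₁ (consₛ sp₂ s₂ sᵇ)) with Subᵇ-resp-↭ p sᵇ | Split-rotate sp₁ sp₂
... | _ , sᵇ′ , q | sp′ , sp″ = _ , consₛ sp′ s₂ (consₛ sp″ s₁ sᵇ′) , ↭-swap _ _ q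
Subᵇ-resp-↭ (↭.trans p₁ p₂) sᵇ with Subᵇ-resp-↭ p₁ sᵇ
... | _ , sᵇ₁ , q₁ with Subᵇ-resp-↭ p₂ sᵇ₁
...   | _ , sᵇ₂ , q₂ = _ , sᵇ₂ , ↭-trans q₁ q₂

record UnRen {n n′ k k′} (g : Fin n → Fin n′) (h : Fin k → Fin k′) (ρ* : Env n′ k′) (ρ : Env n k) : Set where
  constructor mkUnRen
  field
    g-injective : ∀ i j → g i ≡ g j → i ≡ j
    keep-ren    : ∀ i → keep ρ* (g i) ≡ Maybe.map h (keep ρ i)
    bag-ren     : ∀ i → bag ρ* (g i) ↭ bag ρ i
    bag-outside : ∀ j → (∀ i → g i ≢ j) → bag ρ* j ↭ []
open UnRen

map-just-inv : ∀ {k k′} {h : Fin k → Fin k′} {o l} → Maybe.map h o ≡ just l → ∃ λ l₀ → o ≡ just l₀ × l ≡ h l₀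
map-just-inv {o = just l₀} refl = l₀ , refl , refl

UnRen-extE : ∀ {n n′ k k′} {g : Fin n → Fin n′} {h : Fin k → Fin k′} {ρ* ρ} → UnRen g h ρ* ρ →
             UnRen (ext g) (ext h) (extE ρ*) (extE ρ)
UnRen-extE {g = g} {h} {ρ* = ρ*} {ρ} u = mkUnRen inj kr br bo
  where
  inj : ∀ i j → ext g i ≡ ext g j → i ≡ j
  inj zero    zero    _ = refl
  inj (suc i) (suc j) e = cong suc (g-injective u i j (suc-injective e))
  kr : ∀ i → keep (extE ρ*) (ext g i) ≡ Maybe.map (ext h) (keep (extE ρ) i)
  kr zero    = refl
  kr (suc i) = ≡-trans (cong (Maybe.map suc) (keep-ren u i)) (sym (map-ext-suc h (keep ρ i)))
  br : ∀ i → bag (extE ρ*) (ext g i) ↭ bag (extE ρ) i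
  br zero    = ↭-refl
  br (suc i) = bag-ren u i
  bo : ∀ j → (∀ i → ext g i ≢ j) → bag (extE ρ*) j ↭ []
  bo zero    ∉g = ⊥-elim (∉g zero refl)
  bo (suc j) ∉g = bag-outside u j (λ i e → ∉g (suc i) (cong suc e))

UnRen-split : ∀ {n n′ k k′} {g : Fin n → Fin n′} {h : Fin k → Fin k′} {ρ* ρ ρ₁* ρ₂*} → UnRen g h ρ* ρ →
              Split ρ* ρ₁* ρ₂* → ∃ λ ρ₁ → ∃ λ ρ₂ → Split ρ ρ₁ ρ₂ × UnRen g h ρ₁* ρ₁ × UnRen g h ρ₂* ρ₂
UnRen-split {g = g} {ρ = ρ} {ρ₁*} {ρ₂*} u sp = ρ₁ , ρ₂ ,
  mkSplit (λ _ → refl) (λ _ → refl) (λ i → ↭-trans (↭-sym (bag-ren u i)) (bags sp (g i))) ,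
  mkUnRen (g-injective u) (λ i → ≡-trans (keepˡ sp (g i)) (keep-ren u i)) (λ _ → ↭-refl)
          (λ j ∉g → ↭-reflexive (proj₁ (outside j ∉g))) ,
  mkUnRen (g-injective u) (λ i → ≡-trans (keepʳ sp (g i)) (keep-ren u i)) (λ _ → ↭-refl)
          (λ j ∉g → ↭-reflexive (proj₂ (outside j ∉g)))
  where
  ρ₁ ρ₂ : Env _ _
  ρ₁ i = keep ρ i , bag ρ₁* (g i)
  ρ₂ i = keep ρ i , bag ρ₂* (g i)
  outside = λ j ∉g → ++↭[] (↭-trans (↭-sym (bags sp j)) (bag-outside u j ∉g))

UnRen-Empty : ∀ {n n′ k k′} {g : Fin n → Fin n′} {h : Fin k → Fin k′} {ρ* ρ} → UnRen g h ρ* ρ → Empty ρ* → Empty ρ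
UnRen-Empty u em i = ↭-empty-inv (↭-trans (↭-sym (bag-ren u i)) (↭-reflexive (em _)))

Sub-unren  : ∀ {n n′ k k′} {g : Fin n → Fin n′} {h : Fin k → Fin k′} {ρ* ρ} → UnRen g h ρ* ρ →
             ∀ (A : Term n) {w} → Sub ρ* (ren g A) w → ∃ λ w′ → w ≡ ren h w′ × Sub ρ A w′
Subᵇ-unren : ∀ {n n′ k k′} {g : Fin n → Fin n′} {h : Fin k → Fin k′} {ρ* ρ} → UnRen g h ρ* ρ →
             ∀ (P : Bag n) {w} → Subᵇ ρ* (renᵇ g P) w → ∃ λ w′ → w ≡ renᵇ h w′ × Subᵇ ρ P w′
Sub-unren {h = h} u (var i) (keptₛ kj em) with map-just-inv {h = h} (≡-trans (sym (keep-ren u i)) kj)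
... | l₀ , kl₀ , refl = var l₀ , refl , keptₛ kl₀ (UnRen-Empty u em)
Sub-unren {g = g} {h} u (var i) (resₛ {t = t} b others) =
  wk0 t , sym (ren-wk0 h t) ,
  resₛ (↭-trans (↭-sym (bag-ren u i)) b)
       (λ j j≢i → ↭-empty-inv (↭-trans (↭-sym (bag-ren u j)) (↭-reflexive (others (g j) (j≢i ∘ g-injective u j i)))))
Sub-unren u (lam A) (lamₛ s) with Sub-unren (UnRen-extE u) A s
... | w′ , refl , s′ = lam w′ , refl , lamₛ s′
Sub-unren u (app A P) (appₛ sp s sᵇ) with UnRen-split u sp
... | _ , _ , sp′ , u₁ , u₂ with Sub-unren u₁ A s | Subᵇ-unren u₂ P sᵇ
...   | w₁ , refl , s′ | w₂ , refl , sᵇ′ = app w₁ w₂ , refl , appₛ sp′ s′ sᵇ′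
Subᵇ-unren u [] (nilₛ em) = [] , refl , nilₛ (UnRen-Empty u em)
Subᵇ-unren u (L ∷ P) (consₛ sp s sᵇ) with UnRen-split u sp
... | _ , _ , sp′ , u₁ , u₂ with Sub-unren u₁ L s | Subᵇ-unren u₂ P sᵇ
...   | w₁ , refl , s′ | w₂ , refl , sᵇ′ = w₁ ∷ w₂ , refl , consₛ sp′ s′ sᵇ′

-- Substitution commutes with reduction

record Fresh {k k′} (e : Fin k → Fin k′) (x′ : Fin k′) (f′ : Fin k′ → Maybe (Fin k)) : Set where
  constructor mkFresh
  field
    retract : ∀ l → f′ (e l) ≡ just l
    fresh   : f′ x′ ≡ nothing
open Fresh

Fresh-ext : ∀ {k k′} {e : Fin k → Fin k′} {x′ f′} → Fresh e x′ f′ → Fresh (ext e) (suc x′) (extᵐ f′)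
Fresh-ext φ = mkFresh (λ { zero → refl ; (suc l) → cong (Maybe.map suc) (retract φ l) }) (cong (Maybe.map suc) (fresh φ))

fresh-suc : ∀ {k} → Fresh suc zero (pop {k})
fresh-suc = mkFresh (λ _ → refl) refl

PartialInjective : ∀ {m n} → (Fin m → Maybe (Fin n)) → Set
PartialInjective f = ∀ i j {l} → f i ≡ just l → f j ≡ just l → i ≡ j

map-suc≢just-zero : ∀ {n} (o : Maybe (Fin n)) → _≢_ {A = Maybe (Fin (suc n))} (Maybe.map suc o) (just zero)
map-suc≢just-zero (just _) ()
map-suc≢just-zero nothing  ()

PartialInjective-extᵐ : ∀ {m n} {f : Fin m → Maybe (Fin n)} → PartialInjective f → PartialInjective (extᵐ f)
PartialInjective-extᵐ inj zero    zero    _  _  = refl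
PartialInjective-extᵐ {f = f} inj zero    (suc j) refl fj = ⊥-elim (map-suc≢just-zero (f j) fj)
PartialInjective-extᵐ {f = f} inj (suc i) zero    fi refl = ⊥-elim (map-suc≢just-zero (f i) fi)
PartialInjective-extᵐ {f = f} inj (suc i) (suc j) fi fj
  with map-just-inv {h = suc} {o = f i} fi | map-just-inv {h = suc} {o = f j} fj
... | _ , fi′ , refl | _ , fj′ , l≡ = cong suc (inj i j fi′ (≡-trans fj′ (cong just (sym (suc-injective l≡)))))

pop-injective : ∀ {n} → PartialInjective (pop {n})
pop-injective (suc i) (suc j) refl refl = refl

-- The environment on the scope of M induced by ρ through the erasure f:
-- variables kept by f follow ρ (embedded by e), the erased one becomes x′.
transportE : ∀ {m n k k′} → (Fin m → Maybe (Fin n)) → (Fin k → Fin k′) → Fin k′ → Env n k → Env m k′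
transportE f e x′ ρ i = maybe (λ j → Maybe.map e (keep ρ j) , bag ρ j) (just x′ , []) (f i)

transportE-split : ∀ {m n k k′} (f : Fin m → Maybe (Fin n)) (e : Fin k → Fin k′) (x′ : Fin k′) {ρ ρ₁ ρ₂ : Env n k} →
                   Split ρ ρ₁ ρ₂ → Split (transportE f e x′ ρ) (transportE f e x′ ρ₁) (transportE f e x′ ρ₂)
transportE-split f e x′ {ρ} {ρ₁} {ρ₂} sp = mkSplit kˡ kʳ bs
  where
  T = transportE f e x′
  kˡ : ∀ i → keep (T ρ₁) i ≡ keep (T ρ) i
  kˡ i with f i
  ... | just j  = cong (Maybe.map e) (keepˡ sp j)
  ... | nothing = refl
  kʳ : ∀ i → keep (T ρ₂) i ≡ keep (T ρ) i
  kʳ i with f i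
  ... | just j  = cong (Maybe.map e) (keepʳ sp j)
  ... | nothing = refl
  bs : ∀ i → bag (T ρ) i ↭ bag (T ρ₁) i ++ bag (T ρ₂) i
  bs i with f i
  ... | just j  = bags sp j
  ... | nothing = ↭-refl

transportE-Empty : ∀ {m n k k′} (f : Fin m → Maybe (Fin n)) (e : Fin k → Fin k′) (x′ : Fin k′) {ρ : Env n k} →
                   Empty ρ → Empty (transportE f e x′ ρ)
transportE-Empty f e x′ em i with f i
... | just j  = em j
... | nothing = refl

extE-split-unren : ∀ {n k} {ρ : Env n k} {ρ₁* ρ₂* : Env (suc n) (suc k)} → Split (extE ρ) ρ₁* ρ₂* →
                   UnRen suc suc ρ₂* (λ j → keep ρ j , bag ρ₂* (suc j))
extE-split-unren {ρ₂* = ρ₂*} sp = mkUnRen (λ _ _ → suc-injective) (λ i → keepʳ sp (suc i)) (λ _ → ↭-refl) outside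
  where
  outside : ∀ j → (∀ i → suc i ≢ j) → bag ρ₂* j ↭ []
  outside zero    _   = ↭-reflexive (proj₂ (++↭[] (↭-sym (bags sp zero))))
  outside (suc j) ∉suc = ⊥-elim (∉suc j refl)

-- (M⟨R/x⟩){f}⟨ρ⟩ = (M⟨ρ₁⟩)⟨R⟨ρ₂⟩/x′⟩{f′}, where x′ stands for x inside M⟨ρ₁⟩.
Lin-Sub-commute  : ∀ {m n k k′} {f : Fin m → Maybe (Fin n)} {x R M B} {ρ : Env n k} {u}
                   {e : Fin k → Fin k′} {x′ f′} → Fresh e x′ f′ → PartialInjective f → f x ≡ nothing →
                   Lin f x R M B → Sub ρ B u →
                   ∃ λ ρ₁ → ∃ λ ρ₂ → ∃ λ R′ → ∃ λ M′ → Split ρ ρ₁ ρ₂ × Subᵇ ρ₂ R R′ ×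
                   Sub (transportE f e x′ ρ₁) M M′ × Lin f′ x′ R′ M′ u
Linᵇ-Subᵇ-commute : ∀ {m n k k′} {f : Fin m → Maybe (Fin n)} {x R M B} {ρ : Env n k} {u}
                   {e : Fin k → Fin k′} {x′ f′} → Fresh e x′ f′ → PartialInjective f → f x ≡ nothing →
                   Linᵇ f x R M B → Subᵇ ρ B u →
                   ∃ λ ρ₁ → ∃ λ ρ₂ → ∃ λ R′ → ∃ λ M′ → Split ρ ρ₁ ρ₂ × Subᵇ ρ₂ R R′ ×
                   Subᵇ (transportE f e x′ ρ₁) M M′ × Linᵇ f′ x′ R′ M′ u
Lin-Sub-commute {f = f} {ρ = ρ} {e = e} {x′} φ inj fx (keptₗ {i = i} fi q) (keptₛ {j = l} kl em)
  with ↭-empty-inv q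
... | refl = ρ , emptyE ρ , [] , var (e l) , split-all-left ρ , nilₛ (λ _ → refl) ,
             keptₛ kept (transportE-Empty f e x′ {ρ = ρ} em) , keptₗ (retract φ l) ↭-refl
  where
  kept : keep (transportE f e x′ ρ) i ≡ just (e l)
  kept rewrite fi | kl = refl
Lin-Sub-commute {f = f} {ρ = ρ} {e = e} {x′} φ inj fx (keptₗ {i = i} {j} fi q) (resₛ {t = t} b others)
  with ↭-empty-inv q
... | refl = ρ , emptyE ρ , [] , wk0 t , split-all-left ρ , nilₛ (λ _ → refl) , resₛ resource others′ , Lin-wk0 t
  where
  resource : bag (transportE f e x′ ρ) i ↭ t ∷ []
  resource rewrite fi = b
  others′ : ∀ i′ → i′ ≢ i → bag (transportE f e x′ ρ) i′ ≡ []
  others′ i′ i′≢i with f i′ in fi′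
  ... | nothing = refl
  ... | just j′ with j′ ≟ j
  ...   | yes refl = ⊥-elim (i′≢i (inj i′ i fi′ fi))
  ...   | no j′≢j  = others j′ j′≢j
Lin-Sub-commute {f = f} {x = x} {ρ = ρ} {u} {e} {x′} φ inj fx (resₗ q) s with ↭-singleton-inv q
... | refl = emptyE ρ , ρ , u ∷ [] , var x′ , split-all-right ρ , consₛ (split-all-left ρ) s (nilₛ (λ _ → refl)) ,
             keptₛ kept (transportE-Empty f e x′ {ρ = emptyE ρ} (λ _ → refl)) , resₗ ↭-refl
  where
  kept : keep (transportE f e x′ (emptyE ρ)) x ≡ just x′
  kept rewrite fx = refl
Lin-Sub-commute {f = f} {R = R} {ρ = ρ} {e = e} {x′} {f′} φ inj fx (lamₗ l) (lamₛ s)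
  with Lin-Sub-commute (Fresh-ext φ) (PartialInjective-extᵐ inj) (cong (Maybe.map suc) fx) l s
... | ρ₁* , ρ₂* , R′* , M₁′ , sp* , sᵇ* , s* , l*
  with Subᵇ-unren (extE-split-unren sp*) R (subst (λ X → Subᵇ ρ₂* X R′*) (sym (renᵇ-map suc R)) sᵇ*)
...   | R′ , refl , sᵇ′ = ρ₁ , ρ₂ , R′ , lam M₁′ , mkSplit (λ _ → refl) (λ _ → refl) (λ i → bags sp* (suc i)) , sᵇ′ ,
        lamₛ (Sub-resp-≈E ρ₁*≈ s*) , lamₗ (subst (λ X → Lin (extᵐ f′) (suc x′) X M₁′ _) (renᵇ-map suc R′) l*)
  where
  ρ₁ ρ₂ : Env _ _
  ρ₁ j = keep ρ j , bag ρ₁* (suc j)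
  ρ₂ j = keep ρ j , bag ρ₂* (suc j)
  ρ₁*≈ : transportE (extᵐ f) (ext e) (suc x′) ρ₁* ≈E extE (transportE f e x′ ρ₁)
  ρ₁*≈ zero = cong (Maybe.map (ext e)) (keepˡ sp* zero) , ↭-reflexive (proj₁ (++↭[] (↭-sym (bags sp* zero))))
  ρ₁*≈ (suc i) with f i
  ... | just j  = ≡-trans (cong (Maybe.map (ext e)) (keepˡ sp* (suc j))) (map-ext-suc e (keep ρ j)) , ↭-refl
  ... | nothing = refl , ↭-refl
Lin-Sub-commute {f = f} {ρ = ρ} {e = e} {x′} φ inj fx (appₗ q l lᵇ) (appₛ sp s sᵇ)
  with Lin-Sub-commute φ inj fx l s | Linᵇ-Subᵇ-commute φ inj fx lᵇ sᵇ
... | _ , _ , _ , _ , spa , rsa , sa , la | _ , _ , _ , _ , spb , rsb , sb , lb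
  with Split-interchange sp spa spb
...   | sp₀ , sp₁ , sp₂ with Subᵇ-resp-↭ (↭-sym q) (Subᵇ-++ sp₂ rsa rsb)
...     | R′ , rs , pR = _ , _ , R′ , _ , sp₀ , rs , appₛ (transportE-split f e x′ sp₁) sa sb , appₗ (↭-sym pR) la lb
Linᵇ-Subᵇ-commute {f = f} {ρ = ρ} {e = e} {x′} φ inj fx (nilₗ q) (nilₛ em) with ↭-empty-inv q
... | refl = ρ , emptyE ρ , [] , [] , split-all-left ρ , nilₛ (λ _ → refl) ,
             nilₛ (transportE-Empty f e x′ {ρ = ρ} em) , nilₗ ↭-refl
Linᵇ-Subᵇ-commute {f = f} {ρ = ρ} {e = e} {x′} φ inj fx (consₗ q l lᵇ) (consₛ sp s sᵇ)
  with Lin-Sub-commute φ inj fx l s | Linᵇ-Subᵇ-commute φ inj fx lᵇ sᵇ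
... | _ , _ , _ , _ , spa , rsa , sa , la | _ , _ , _ , _ , spb , rsb , sb , lb
  with Split-interchange sp spa spb
...   | sp₀ , sp₁ , sp₂ with Subᵇ-resp-↭ (↭-sym q) (Subᵇ-++ sp₂ rsa rsb)
...     | R′ , rs , pR = _ , _ , R′ , _ , sp₀ , rs , consₛ (transportE-split f e x′ sp₁) sa sb , consₗ (↭-sym pR) la lb

β-instance : ∀ {n k} {ρ : Env n k} {M P B u} → B ∈ eraseS pop (bagSubS zero (map shift P) (M ∷ [])) → Sub ρ B u →
             ∃ λ t → Sub ρ (app (lam M) P) t × t ⟶∋ u
β-instance B∈ s with Lin-Sub-commute fresh-suc pop-injective refl (β-summand⇒Lin B∈) s
... | _ , _ , R′ , M′ , sp , sᵇ , sM , l =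
  app (lam M′) R′ , appₛ sp (lamₛ (Sub-resp-≈E (λ { zero → refl , ↭-refl ; (suc i) → refl , ↭-refl }) sM)) sᵇ ,
  Lin⇒β-summand l

⟶∋-instance  : ∀ {n k} {ρ : Env n k} {A B u} → A ⟶∋ B → Sub ρ B u → ∃ λ t → Sub ρ A t × t ⟶∋ u
⟶∋ᵇ-instance : ∀ {n k} {ρ : Env n k} {A B u} → A ⟶∋ᵇ B → Subᵇ ρ B u → ∃ λ t → Subᵇ ρ A t × t ⟶∋ᵇ u
⟶∋-instance (_ , β M P , B∈) s = β-instance B∈ s
⟶∋-instance (_ , lam r , B∈) s with ∈-map⁻ lam B∈
... | _ , B₁∈ , refl with s
...   | lamₛ s₁ with ⟶∋-instance (_ , r , B₁∈) s₁
...     | t₁ , s′ , (_ , r′ , u∈) = lam t₁ , lamₛ s′ , _ , lam r′ , ∈-map⁺ lam u∈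
⟶∋-instance (_ , appL {P = P} r , B∈) s with ∈-map⁻ (λ M′ → app M′ P) B∈
... | _ , B₁∈ , refl with s
...   | appₛ {P′ = Q} sp s₁ sᵇ with ⟶∋-instance (_ , r , B₁∈) s₁
...     | t₁ , s′ , (_ , r′ , u∈) = app t₁ Q , appₛ sp s′ sᵇ , _ , appL r′ , ∈-map⁺ (λ M′ → app M′ Q) u∈
⟶∋-instance (_ , appR {M = M} r , B∈) s with ∈-map⁻ (app M) B∈
... | _ , B₁∈ , refl with s
...   | appₛ {M′ = t₁} sp s₁ sᵇ with ⟶∋ᵇ-instance (_ , r , B₁∈) sᵇ
...     | Q , sᵇ′ , (_ , r′ , u∈) = app t₁ Q , appₛ sp s₁ sᵇ′ , _ , appR r′ , ∈-map⁺ (app t₁) u∈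
⟶∋ᵇ-instance (_ , here {P = P} r , B∈) s with ∈-map⁻ (_∷ P) B∈
... | _ , B₁∈ , refl with s
...   | consₛ {P′ = Q} sp s₁ sᵇ with ⟶∋-instance (_ , r , B₁∈) s₁
...     | t₁ , s′ , (_ , r′ , u∈) = t₁ ∷ Q , consₛ sp s′ sᵇ , _ , here r′ , ∈-map⁺ (_∷ Q) u∈
⟶∋ᵇ-instance (_ , there {L = L} r , B∈) s with ∈-map⁻ (L ∷_) B∈
... | _ , B₁∈ , refl with s
...   | consₛ {L′ = t₁} sp s₁ sᵇ with ⟶∋ᵇ-instance (_ , r , B₁∈) sᵇ
...     | Q , sᵇ′ , (_ , r′ , u∈) = t₁ ∷ Q , consₛ sp s₁ sᵇ′ , _ , there r′ , ∈-map⁺ (t₁ ∷_) u∈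

≈-instance  : ∀ {n k} {ρ : Env n k} {A B u} → A ≈ B → Sub ρ B u → ∃ λ t → Sub ρ A t × t ≈ u
≈ᵇ-instance : ∀ {n k} {ρ : Env n k} {A B u} → A ≈ᵇ B → Subᵇ ρ B u → ∃ λ t → Subᵇ ρ A t × t ≈ᵇ u
≈-instance (var i) s = _ , s , ≈-refl _
≈-instance (lam A≈) (lamₛ s) with ≈-instance A≈ s
... | t , s′ , t≈ = lam t , lamₛ s′ , lam t≈
≈-instance (app A≈ P≈) (appₛ sp s sᵇ) with ≈-instance A≈ s | ≈ᵇ-instance P≈ sᵇ
... | t , s′ , t≈ | Q , sᵇ′ , Q≈ = app t Q , appₛ sp s′ sᵇ′ , app t≈ Q≈
≈ᵇ-instance [] (nilₛ em) = [] , nilₛ em , []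
≈ᵇ-instance (L≈ ∷ P≈) (consₛ sp s sᵇ) with ≈-instance L≈ s | ≈ᵇ-instance P≈ sᵇ
... | t , s′ , t≈ | Q , sᵇ′ , Q≈ = t ∷ Q , consₛ sp s′ sᵇ′ , t≈ ∷ Q≈
≈ᵇ-instance (swap L L′ P) (consₛ sp₁ s₁ (consₛ sp₂ s₂ sᵇ)) with Split-rotate sp₁ sp₂
... | sp′ , sp″ = _ , consₛ sp′ s₂ (consₛ sp″ s₁ sᵇ) , swap _ _ _
≈ᵇ-instance (trans P≈₁ P≈₂) sᵇ with ≈ᵇ-instance P≈₂ sᵇ
... | _ , sᵇ₁ , Q≈₁ with ≈ᵇ-instance P≈₁ sᵇ₁
...   | _ , sᵇ₀ , Q≈₀ = _ , sᵇ₀ , trans Q≈₀ Q≈₁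

⟶∋*-instance : ∀ {n k} {ρ : Env n k} {A B w} → A ⟶∋* B → Sub ρ B w → ∃ λ t → Sub ρ A t × t ↠∋ w
⟶∋*-instance ε s = _ , s , ↠∋-refl _
⟶∋*-instance (inj₁ A⟶B ◅ path) s with ⟶∋*-instance path s
... | _ , s₁ , t₁↠ with ⟶∋-instance A⟶B s₁
...   | t , s′ , t⟶ = t , s′ , ↠∋-trans (⟶∋⇒↠∋ t⟶) t₁↠
⟶∋*-instance (inj₂ A≈B ◅ path) s with ⟶∋*-instance path s
... | _ , s₁ , t₁↠ with ≈-instance A≈B s₁
...   | t , s′ , t≈ = t , s′ , ↠∋-trans (≈⇒↠∋ t≈) t₁↠

record Postponed {m k k′} (σ : Env m k) (θ : Env m k′) (x : Fin m) (e : Fin k → Fin k′) (x′ : Fin k′) : Set where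
  constructor mkPostponed
  field
    x-kept      : keep θ x ≡ just x′
    x-empty     : bag θ x ≡ []
    others-keep : ∀ i → i ≢ x → keep θ i ≡ Maybe.map e (keep σ i)
    others-bag  : ∀ i → i ≢ x → bag θ i ↭ bag σ i
open Postponed

postponeE : ∀ {m k k′} → Env m k → Fin m → (Fin k → Fin k′) → Fin k′ → Env m k′
postponeE σ x e x′ i with i ≟ x
... | yes _ = just x′ , []
... | no _  = Maybe.map e (keep σ i) , bag σ i

postponeE-Postponed : ∀ {m k k′} (σ : Env m k) x (e : Fin k → Fin k′) x′ → Postponed σ (postponeE σ x e x′) x e x′
postponeE-Postponed σ x e x′ =
  mkPostponed (at proj₁) (at proj₂) (λ i i≢x → else i i≢x proj₁) (λ i i≢x → ↭-reflexive (else i i≢x proj₂))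
  where
  at : ∀ {B : Set} (π : Maybe _ × Bag 0 → B) → π (postponeE σ x e x′ x) ≡ π (just x′ , [])
  at π with x ≟ x
  ... | yes _  = refl
  ... | no x≢x = ⊥-elim (x≢x refl)
  else : ∀ i → i ≢ x → ∀ {B : Set} (π : Maybe _ × Bag 0 → B) →
         π (postponeE σ x e x′ i) ≡ π (Maybe.map e (keep σ i) , bag σ i)
  else i i≢x π with i ≟ x
  ... | yes i≡x = ⊥-elim (i≢x i≡x)
  ... | no _    = refl

postponeE-Empty : ∀ {m k k′} (σ : Env m k) x (e : Fin k → Fin k′) x′ → (∀ i → i ≢ x → bag σ i ≡ []) →
                  Empty (postponeE σ x e x′)
postponeE-Empty σ x e x′ em i with i ≟ x
... | yes _  = refl
... | no i≢x = em i i≢x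

Postponed-merge : ∀ {m k k′} {σ σ₁ σ₂ : Env m k} {θ₁ θ₂ : Env m k′} {x e x′} → Split σ σ₁ σ₂ →
                  Postponed σ₁ θ₁ x e x′ → Postponed σ₂ θ₂ x e x′ →
                  Split (mergeE θ₁ θ₁ θ₂) θ₁ θ₂ × Postponed σ (mergeE θ₁ θ₁ θ₂) x e x′
Postponed-merge {θ₁ = θ₁} {θ₂} {x} {e} sp p₁ p₂ =
  Split-mergeE θ₁ (λ _ → refl) same-keep ,
  mkPostponed (x-kept p₁) (cong₂ _++_ (x-empty p₁) (x-empty p₂))
              (λ i i≢x → ≡-trans (others-keep p₁ i i≢x) (cong (Maybe.map e) (keepˡ sp i)))
              (λ i i≢x → ↭-trans (++⁺ (others-bag p₁ i i≢x) (others-bag p₂ i i≢x)) (↭-sym (bags sp i)))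
  where
  same-keep : ∀ i → keep θ₂ i ≡ keep θ₁ i
  same-keep i with i ≟ x
  ... | yes refl = ≡-trans (x-kept p₂) (sym (x-kept p₁))
  ... | no i≢x   = ≡-trans (others-keep p₂ i i≢x)
                   (≡-trans (cong (Maybe.map e) (≡-trans (keepʳ sp i) (sym (keepˡ sp i)))) (sym (others-keep p₁ i i≢x)))

Split-map-wk0 : ∀ {m k n} {σ σ₁ σ₂ : Env m k} → Split σ σ₁ σ₂ → ∀ x →
                map (wk0 {n}) (bag σ x) ↭ map wk0 (bag σ₁ x) ++ map wk0 (bag σ₂ x)
Split-map-wk0 {σ₁ = σ₁} {σ₂} sp x = ↭-trans (↭-map⁺ wk0 (bags sp x)) (↭-reflexive (map-++ wk0 (bag σ₁ x) (bag σ₂ x)))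

-- M⟨σ⟩ = M⟨θ⟩⟨σ(x)/x′⟩: the resources of an erased variable x can be substituted last.
Sub-postpone  : ∀ {m k k′} {σ : Env m k} {x : Fin m} {M v} {e : Fin k → Fin k′} {x′ f′} → Fresh e x′ f′ →
                keep σ x ≡ nothing → Sub σ M v →
                ∃ λ θ → ∃ λ M′ → Sub θ M M′ × Lin f′ x′ (map wk0 (bag σ x)) M′ v × Postponed σ θ x e x′
Subᵇ-postpone : ∀ {m k k′} {σ : Env m k} {x : Fin m} {M v} {e : Fin k → Fin k′} {x′ f′} → Fresh e x′ f′ →
                keep σ x ≡ nothing → Subᵇ σ M v →
                ∃ λ θ → ∃ λ M′ → Subᵇ θ M M′ × Linᵇ f′ x′ (map wk0 (bag σ x)) M′ v × Postponed σ θ x e x′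
Sub-postpone {σ = σ} {x} {e = e} {x′} {f′} φ kx (keptₛ {i = i} {l} kl em) with i ≟ x
... | yes refl = ⊥-elim (nothing≢just (≡-trans (sym kx) kl))
  where nothing≢just : ∀ {A : Set} {a : A} → nothing ≢ just a
        nothing≢just ()
... | no i≢x = postponeE σ x e x′ , var (e l) ,
  keptₛ (≡-trans (others-keep P i i≢x) (cong (Maybe.map e) kl)) (postponeE-Empty σ x e x′ (λ i _ → em i)) ,
  subst (λ X → Lin f′ x′ (map wk0 X) (var (e l)) (var l)) (sym (em x)) (keptₗ (retract φ l) ↭-refl) , P
  where P = postponeE-Postponed σ x e x′
Sub-postpone {σ = σ} {x} {e = e} {x′} {f′} φ kx (resₛ {i = i} {t} b others) with i ≟ x
... | yes refl = postponeE σ x e x′ , var x′ , keptₛ (x-kept P) (postponeE-Empty σ x e x′ others) ,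
                 resₗ (↭-map⁺ wk0 b) , P
  where P = postponeE-Postponed σ x e x′
... | no i≢x = postponeE σ x e x′ , wk0 t ,
  resₛ (↭-trans (others-bag P i i≢x) b) others′ ,
  subst (λ X → Lin f′ x′ (map wk0 X) (wk0 t) (wk0 t)) (sym (others x (i≢x ∘ sym))) (Lin-wk0 t) , P
  where
  P = postponeE-Postponed σ x e x′
  others′ : ∀ j → j ≢ i → bag (postponeE σ x e x′) j ≡ []
  others′ j j≢i with j ≟ x
  ... | yes _ = refl
  ... | no _  = others j j≢i
Sub-postpone {σ = σ} {x} {e = e} {x′} {f′} φ kx (lamₛ s)
  with Sub-postpone (Fresh-ext φ) (cong (Maybe.map suc) kx) s
... | θ* , M₁′ , s* , l* , P* =
  θ , lam M₁′ , lamₛ (Sub-resp-≈E θ*≈ s*) ,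
  lamₗ (subst (λ X → Lin (extᵐ f′) (suc x′) X M₁′ _) (sym (map-shift-wk0 (bag σ x))) l*) ,
  mkPostponed (x-kept P) (x-empty P*) (others-keep P) (λ i i≢x → others-bag P* (suc i) (suc-≢ i≢x))
  where
  P = postponeE-Postponed σ x e x′
  θ : Env _ _
  θ i = keep (postponeE σ x e x′) i , bag θ* (suc i)
  θ*≈ : θ* ≈E extE θ
  θ*≈ zero = others-keep P* zero (λ ()) , others-bag P* zero (λ ())
  θ*≈ (suc i) with i ≟ x
  ... | yes refl = x-kept P* , ↭-refl
  ... | no i≢x   = ≡-trans (others-keep P* (suc i) (suc-≢ i≢x)) (map-ext-suc e (keep σ i)) , ↭-refl
Sub-postpone {x = x} φ kx (appₛ sp s sᵇ)
  with Sub-postpone φ (≡-trans (keepˡ sp x) kx) s | Subᵇ-postpone φ (≡-trans (keepʳ sp x) kx) sᵇ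
... | _ , M′ , s′ , l , P₁ | _ , Q , sᵇ′ , lᵇ , P₂ with Postponed-merge sp P₁ P₂
...   | sp′ , P = _ , app M′ Q , appₛ sp′ s′ sᵇ′ , appₗ (Split-map-wk0 sp x) l lᵇ , P
Subᵇ-postpone {σ = σ} {x} {e = e} {x′} {f′} φ kx (nilₛ em) =
  postponeE σ x e x′ , [] , nilₛ (postponeE-Empty σ x e x′ (λ i _ → em i)) ,
  subst (λ X → Linᵇ f′ x′ (map wk0 X) [] []) (sym (em x)) (nilₗ ↭-refl) , postponeE-Postponed σ x e x′
Subᵇ-postpone {x = x} φ kx (consₛ sp s sᵇ)
  with Sub-postpone φ (≡-trans (keepˡ sp x) kx) s | Subᵇ-postpone φ (≡-trans (keepʳ sp x) kx) sᵇ
... | _ , L′ , s′ , l , P₁ | _ , Q , sᵇ′ , lᵇ , P₂ with Postponed-merge sp P₁ P₂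
...   | sp′ , P = _ , L′ ∷ Q , consₛ sp′ s′ sᵇ′ , consₗ (Split-map-wk0 sp x) l lᵇ , P

-- Normal forms are testable

data Nf {n} : Term n → Set
data Ne {n} : Term n → Set

data Nf {n} where
  lam : ∀ {M} → Nf M → Nf (lam M)
  ne  : ∀ {M} → Ne M → Nf M

data Ne {n} where
  var : ∀ {i} → Ne (var i)
  app : ∀ {M P} → Ne M → All Nf P → Ne (app M P)

Irreducible : ∀ {n} → Term n → Set
Irreducible N = ∀ 𝕄 → N ⟶ 𝕄 → ⊥

Irreducible⇒Nf : ∀ {n} (N : Term n) → Irreducible N → Nf N
Irreducibleᵇ⇒Nf : ∀ {n} (P : Bag n) → (∀ ℙ → P ⟶ᵇ ℙ → ⊥) → All Nf P
Irreducible⇒Nf (var i)         _   = ne var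
Irreducible⇒Nf (lam M)         irr = lam (Irreducible⇒Nf M (λ _ r → irr _ (lam r)))
Irreducible⇒Nf (app (var i) P) irr = ne (app var (Irreducibleᵇ⇒Nf P (λ _ r → irr _ (appR r))))
Irreducible⇒Nf (app (lam M) P) irr = ⊥-elim (irr _ (β M P))
Irreducible⇒Nf (app (app M Q) P) irr with Irreducible⇒Nf (app M Q) (λ _ r → irr _ (appL r))
... | ne M′ = ne (app M′ (Irreducibleᵇ⇒Nf P (λ _ r → irr _ (appR r))))
Irreducibleᵇ⇒Nf []      _   = All.[]
Irreducibleᵇ⇒Nf (L ∷ P) irr =
  Irreducible⇒Nf L (λ _ r → irr _ (here r)) All.∷ Irreducibleᵇ⇒Nf P (λ _ r → irr _ (there r))

Test : Term 0 × List (Bag 0) → Set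
Test (w , Ps) = apps w Ps ↠∋ I

chain : List (Term 0 × List (Bag 0)) → Term 0 → Term 0
chain []               X = X
chain ((w , Ps) ∷ wPs) X = app (apps w Ps) (chain wPs X ∷ [])

chainᶻ : List (List (Bag 0)) → Term 1 → Term 1
chainᶻ []         X = X
chainᶻ (Ps ∷ Pss) X = app (apps (var zero) Ps) (chainᶻ Pss X ∷ [])

Lin-apps : ∀ {m k} {f : Fin m → Maybe (Fin k)} {x R A B} (Ps : List (Bag 0)) → Lin f x R A B →
           Lin f x R (apps A Ps) (apps B Ps)
Lin-apps []       l = l
Lin-apps {R = R} (P ∷ Ps) l = Lin-apps Ps (appₗ (↭-reflexive (sym (++-identityʳ R))) l (Linᵇ-wk0 P))

Lin-chainᶻ : (K : Term 0) (wPs : List (Term 0 × List (Bag 0))) →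
             Lin pop zero (map proj₁ wPs) (chainᶻ (map proj₂ wPs) (wk0 K)) (chain wPs (wk0 K))
Lin-chainᶻ K []              = Lin-wk0 K
Lin-chainᶻ K ((w , Ps) ∷ wPs) =
  appₗ ↭-refl (Lin-apps Ps (resₗ ↭-refl)) (consₗ (↭-reflexive (sym (++-identityʳ _))) (Lin-chainᶻ K wPs) (nilₗ ↭-refl))

chain-↠∋ : (wPs : List (Term 0 × List (Bag 0))) (X : Term 0) → All Test wPs → chain wPs X ↠∋ X
chain-↠∋ []               X All.[]         = ↠∋-refl X
chain-↠∋ ((w , Ps) ∷ wPs) X (t All.∷ tests) =
  ↠∋-trans (↠∋-appL _ t) (↠∋-trans (⟶∋⇒↠∋ (Lin⇒β-summand (resₗ ↭-refl))) (chain-↠∋ wPs X tests))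

Erased : ∀ {n} → Env n 0 → Set
Erased σ = ∀ i → keep σ i ≡ nothing

resourceE : ∀ {n} → Fin n → Term 0 → Env n 0
resourceE i K j with j ≟ i
... | yes _ = nothing , K ∷ []
... | no _  = nothing , []

resourceE-Erased : ∀ {n} (i : Fin n) K → Erased (resourceE i K)
resourceE-Erased i K j with j ≟ i
... | yes _ = refl
... | no _  = refl

resourceE-Sub : ∀ {n} (i : Fin n) K → Sub (resourceE i K) (var i) (wk0 K)
resourceE-Sub i K = resₛ (↭-reflexive at) others
  where
  at : bag (resourceE i K) i ≡ K ∷ []
  at with i ≟ i
  ... | yes _  = refl
  ... | no i≢i = ⊥-elim (i≢i refl)
  others : ∀ j → j ≢ i → bag (resourceE i K) j ≡ []
  others j j≢i with j ≟ i
  ... | yes j≡i = ⊥-elim (j≢i j≡i)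
  ... | no _    = refl

_+E_ : ∀ {n} → Env n 0 → Env n 0 → Env n 0
(σ₁ +E σ₂) i = nothing , bag σ₁ i ++ bag σ₂ i

+E-split : ∀ {n} {σ₁ σ₂ : Env n 0} → Erased σ₁ → Erased σ₂ → Split (σ₁ +E σ₂) σ₁ σ₂
+E-split e₁ e₂ = mkSplit e₁ e₂ (λ _ → ↭-refl)

Nf-testable  : ∀ {n} {N : Term n} → Nf N →
               ∃ λ σ → ∃ λ Ps → ∃ λ v → Erased σ × Sub σ N v × Test (v , Ps)
Ne-reaches   : ∀ {n} {N : Term n} → Ne N → (K : Term 0) →
               ∃ λ σ → ∃ λ v → Erased σ × Sub σ N v × v ↠∋ K
Nfᵇ-testable : ∀ {n} {Q : Bag n} → All Nf Q →
               ∃ λ σ → ∃ λ wPs → Erased σ × Subᵇ σ Q (map proj₁ wPs) × All Test wPs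
Nf-testable (ne N) with Ne-reaches N I
... | σ , v , erased , s , v↠I = σ , [] , v , erased , s , v↠I
Nf-testable (lam N) with Nf-testable N
... | σ′ , Ps , v , erased , s , test with Sub-postpone fresh-suc (erased zero) s
...   | θ , N′ , sθ , l , P = σ , bag σ′ zero ∷ Ps , lam N′ , (λ i → erased (suc i)) , lamₛ (Sub-resp-≈E θ≈ sθ) ,
        ↠∋-trans (↠∋-apps Ps (⟶∋⇒↠∋ (Lin⇒β-summand l))) test
  where
  σ : Env _ 0
  σ i = σ′ (suc i)
  θ≈ : θ ≈E extE σ
  θ≈ zero    = x-kept P , ↭-reflexive (x-empty P)
  θ≈ (suc i) = ≡-trans (others-keep P (suc i) (λ ()))
                       (≡-trans (map-nothing (erased (suc i))) (sym (map-nothing (erased (suc i))))) ,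
               others-bag P (suc i) (λ ())
Ne-reaches (var {i = i}) K =
  resourceE i K , wk0 K , resourceE-Erased i K , resourceE-Sub i K , subst (_↠∋ K) (sym (wk0-id K)) (↠∋-refl K)
-- N Q with Q = [N₁ … Nₘ]: send N to λz. z Ps₁ [ ⋯ [z Psₘ [K]] ⋯ ], fed with the instances wᵢ of the Nᵢ.
Ne-reaches (app {P = Q} N Nfs) K with Nfᵇ-testable Nfs
... | σQ , wPs , erasedQ , sQ , tests with Ne-reaches N (lam (chainᶻ (map proj₂ wPs) (wk0 K)))
...   | σN , v , erasedN , sN , v↠ =
        σN +E σQ , app v (map proj₁ wPs) , (λ _ → refl) , appₛ (+E-split erasedN erasedQ) sN sQ ,
        ↠∋-trans (↠∋-appL _ v↠) (↠∋-trans (⟶∋⇒↠∋ (Lin⇒β-summand (Lin-chainᶻ K wPs)))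
                 (subst (chain wPs (wk0 K) ↠∋_) (wk0-id K) (chain-↠∋ wPs (wk0 K) tests)))
Nfᵇ-testable All.[] = (λ _ → nothing , []) , [] , (λ _ → refl) , nilₛ (λ _ → refl) , All.[]
Nfᵇ-testable (N All.∷ Nfs) with Nf-testable N | Nfᵇ-testable Nfs
... | σL , Ps , w , erasedL , sL , test | σR , wPs , erasedR , sR , tests =
  σL +E σR , (w , Ps) ∷ wPs , (λ _ → refl) , consₛ (+E-split erasedL erasedR) sL sR , test All.∷ tests

proposition6p4 : ∀ {n} (M : Term n) → (∀ (i : Fin n) → FreeIn i M) →
    (∃[ 𝕟 ] ((M ∷ []) ↠ 𝕟 × Normal 𝕟 × 𝕟 ≢ [])) →
    ∃[ Ps ] ∃[ P' ] ∃[ 𝕄 ]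
      (eraseS allZero (multiSubS (apps M Ps ∷ []) P') ↠ (I ∷ 𝕄))
proposition6p4 M _ ([] , _ , _ , 𝕟≢[]) = ⊥-elim (𝕟≢[] refl)
proposition6p4 M _ (N ∷ _ , M↠ , irrN All.∷ _ , _) with ↠-origin M↠ (here refl)
... | _ , here refl , M⟶*N =
  let σ , Ps , _ , erased , sN , test = Nf-testable (Irreducible⇒Nf N irrN)
      _ , sM , M⟨σ⟩↠ = ⟶∋*-instance M⟶*N sN
  in  Ps , bag σ , ↠∋-summand (Sub⇒∈-multiSubS (Sub-apps Ps sM) erased) (↠∋-trans (↠∋-apps Ps M⟨σ⟩↠) test)
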